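{- Let $n\ge1$ and let $\mathcal{A}^B_n$ be the set of $B$-arc permutations in $B_n$. Then $$\sum_{\pi\in \mathcal{A}^B_n} q^{\mathrm{fmaj}(\pi)}=[2n]_q\prod_{i=1}^{n-1} (1+q^{2i-1}),\qquad \sum_{\pi\in \mathcal{A}^B_n} \mathrm{sign}(\pi) q^{\mathrm{fmaj}(\pi)}=[2n]_{(-1)^nq} \prod_{i=1}^{n-1}(1+(-1)^{i}q^{2i-1}),$$ $$\sum_{\pi\in \mathcal{A}^B_n} (-1)^{\mathrm{neg}(\pi)} q^{\mathrm{fmaj}(\pi)}=[2n]_{ -q} \prod_{i=1}^{n-1} (1-q^{2i-1}),\qquad \sum_{\pi\in \mathcal{A}^B_n} \mathrm{sign}(|\pi|) q^{\mathrm{fmaj}(\pi)}=[2n]_{(-1)^{n-1}q} \prod_{i=1}^{n-1} (1+(-1)^{i-1}q^{2i-1}).$$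
   Context: $B_n$ is the group of bijections $\pi$ of $\{\pm1,\dots,\pm n\}$ with $\pi(-a)=-\pi(a)$, written $\pi=[\pi(1),\dots,\pi(n)]$. Let $\mathcal{O}_n$ be a circle with $2n$ points labeled $-1,\dots,-n,1,\dots,n$ in clockwise order; an interval in $\mathcal{O}_n$ is a set of cyclically consecutive points. $\pi\in B_n$ is a $B$-arc permutation if for every $1\le j\le n$ the set $\{\pi(j),\dots,\pi(n)\}$ is an interval in $\mathcal{O}_n$. Descents are with respect to the order $-1<-2<\cdots<-n<1<\cdots<n$: $\mathrm{Des}(\pi)=\{1\le i\le n-1:\pi(i)>\pi(i+1)\}$, $\mathrm{maj}(\pi)=\sum_{i\in\mathrm{Des}(\pi)}i$, $\mathrm{neg}(\pi)=\#\{i:\pi(i)<0\}$, $\mathrm{fmaj}(\pi)=2\,\mathrm{maj}(\pi)+\mathrm{neg}(\pi)$. $|\pi|\in S_n$ is $|\pi(1)|\cdots|\pi(n)|$, $\mathrm{sign}(|\pi|)=(-1)^{\mathrm{inv}(|\pi|)}$, and $\mathrm{sign}(\pi)=(-1)^{\mathrm{neg}(\pi)}\mathrm{sign}(|\pi|)$ is the sign character of $B_n$. $[m]_z=1+z+\dots+z^{m-1}$. -}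

module Defs where

open import Data.Bool using (Bool; true; false; _∧_; _∨_; if_then_else_; not)
open import Data.Nat as ℕ using (ℕ; zero; suc; _≤ᵇ_; _<ᵇ_; _≡ᵇ_)
import Data.Nat.Properties as ℕ
open import Data.Integer as ℤ using (ℤ; +_; -[1+_]; ∣_∣)
open import Data.List using (List; []; _∷_; map; _++_; concatMap; filter; foldr; length; upTo; applyUpTo)
open import Data.Bool.ListAction using (any; all)
open import Data.Bool using (T; T?)
open import Relation.Binary.PropositionalEquality using (_≡_)

-- Polynomials in q with integer coefficients, as coefficient lists
-- (constant term first).  Equality is coefficientwise (so trailing
-- zeros are irrelevant).

Poly : Set
Poly = List ℤ

coeff : Poly → ℕ → ℤ
coeff []       _       = + 0
coeff (a ∷ p)  zero    = a
coeff (a ∷ p)  (suc k) = coeff p k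

_≈P_ : Poly → Poly → Set
p ≈P r = ∀ k → coeff p k ≡ coeff r k

infix 4 _≈P_
infixl 6 _⊕_
infixl 7 _⊗_

_⊕_ : Poly → Poly → Poly
[]      ⊕ r       = r
p       ⊕ []      = p
(a ∷ p) ⊕ (b ∷ r) = (a ℤ.+ b) ∷ (p ⊕ r)

scale : ℤ → Poly → Poly
scale c = map (c ℤ.*_)

_⊗_ : Poly → Poly → Poly
[]      ⊗ r = []
(a ∷ p) ⊗ r = scale a r ⊕ (+ 0 ∷ (p ⊗ r))

constP : ℤ → Poly
constP c = c ∷ []

oneP : Poly
oneP = constP (+ 1)

monoP : ℤ → ℕ → Poly
monoP c zero    = c ∷ []
monoP c (suc k) = + 0 ∷ monoP c k

sumP : List Poly → Poly
sumP = foldr _⊕_ []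

prodP : List Poly → Poly
prodP = foldr _⊗_ oneP

negOnePow : ℕ → ℤ
negOnePow zero    = + 1
negOnePow (suc k) = ℤ.- negOnePow k

-- [m]_{c q} = 1 + (c q) + ... + (c q)^{m-1}
qInt : ℤ → ℕ → Poly
qInt c m = sumP (map (λ j → monoP (c ℤ.^ j) j) (upTo m))

-- ∏_{i=1}^{n-1} (1 + s(i) q^{2i-1})
prodFactor : (ℕ → ℤ) → ℕ → Poly
prodFactor s n =
  prodP (map (λ i → oneP ⊕ monoP (s i) (2 ℕ.* i ℕ.∸ 1)) (applyUpTo suc (n ℕ.∸ 1)))

-- Signed permutations.  π ∈ B_n is represented by its window
-- [π(1),…,π(n)] as a list of nonzero integers.

alphabet : ℕ → List ℤ
alphabet n = map (λ i → -[1+ i ]) (upTo n) ++ map (λ i → + suc i) (upTo n)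

words : ℕ → List ℤ → List (List ℤ)
words zero    A = [] ∷ []
words (suc k) A = concatMap (λ a → map (a ∷_) (words k A)) A

memℕ : ℕ → List ℕ → Bool
memℕ x []       = false
memℕ x (y ∷ ys) = (x ≡ᵇ y) ∨ memℕ x ys

distinctℕ : List ℕ → Bool
distinctℕ []       = true
distinctℕ (x ∷ xs) = not (memℕ x xs) ∧ distinctℕ xs

-- a word of length n over {±1..±n} is the window of an element of B_n
-- iff the absolute values are pairwise distinct
isSignedPerm : List ℤ → Bool
isSignedPerm w = distinctℕ (map ∣_∣ w)

Bn : ℕ → List (List ℤ)
Bn n = filter (λ w → T? (isSignedPerm w)) (words n (alphabet n))

-- The circle O_n: the points -1,…,-n,1,…,n in clockwise order occupy
-- positions 0,…,2n-1.  The same position is the rank in the order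
-- -1 < -2 < … < -n < 1 < … < n.

pos : ℕ → ℤ → ℕ
pos n -[1+ i ]  = i
pos n (+ zero)  = 0      -- never used (0 is not a point)
pos n (+ suc i) = n ℕ.+ i

cdist : ℕ → ℕ → ℕ → ℕ
cdist m s p = if s ≤ᵇ p then p ℕ.∸ s else (p ℕ.+ m) ℕ.∸ s

-- S is an interval of O_n: there is a start point s such that the
-- points of S are exactly the |S| points s, s+1, …, s+|S|-1 (cyclically)
_≡Bool_ : Bool → Bool → Bool
true  ≡Bool b = b
false ≡Bool b = not b

isInterval : ℕ → List ℤ → Bool
isInterval n S =
  any (λ s → all (λ p → memℕ p (map (pos n) S) ≡Bool (cdist (2 ℕ.* n) s p <ᵇ length S))
                 (upTo (2 ℕ.* n)))
      (upTo (2 ℕ.* n))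

suffixes : List ℤ → List (List ℤ)
suffixes []       = []
suffixes (x ∷ xs) = (x ∷ xs) ∷ suffixes xs

isBArc : ℕ → List ℤ → Bool
isBArc n π = all (isInterval n) (suffixes π)

ABn : ℕ → List (List ℤ)
ABn n = filter (λ π → T? (isBArc n π)) (Bn n)

-- maj with positions starting at index i (the first letter is at i)
majFrom : ℕ → ℕ → List ℤ → ℕ
majFrom n i []           = 0
majFrom n i (x ∷ [])     = 0
majFrom n i (x ∷ y ∷ w)  =
  (if pos n y <ᵇ pos n x then i else 0) ℕ.+ majFrom n (suc i) (y ∷ w)

maj : ℕ → List ℤ → ℕ
maj n = majFrom n 1

isNeg : ℤ → Bool
isNeg -[1+ _ ] = true
isNeg (+ _)    = false

neg : List ℤ → ℕ
neg []      = 0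
neg (x ∷ w) = (if isNeg x then 1 else 0) ℕ.+ neg w

fmaj : ℕ → List ℤ → ℕ
fmaj n π = 2 ℕ.* maj n π ℕ.+ neg π

inv : List ℕ → ℕ
inv []      = 0
inv (x ∷ w) = length (filter (λ y → y ℕ.<? x) w) ℕ.+ inv w

signAbs : List ℤ → ℤ
signAbs π = negOnePow (inv (map ∣_∣ π))

-- sign(π) = (-1)^{neg π} sign(|π|)
signB : List ℤ → ℤ
signB π = negOnePow (neg π) ℤ.* signAbs π

genFun : ℕ → (List ℤ → ℤ) → Poly
genFun n w = sumP (map (λ π → monoP (w π) (fmaj n π)) (ABn n))

module Submission where

-- Let p be the position of π(n) on the circle O_n (0 ≤ p < 2n).
-- Reading π from right to left, the letters seen so far always form an
-- arc of O_n, and each new letter extends that arc either to the left or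
-- to the right; conversely every such choice sequence e ∈ {0,1}^(n-1)
-- gives a B-arc permutation.  So A^B_n ≅ {0,…,2n-1} × {0,1}^(n-1).  Along
-- this construction
--   fmaj π  = (2n-1-p) + Σ_{right steps} (2i-1),
--   inv|π| ≡ (n-1)(2n-1-p) + Σ_{right steps} (i-1)   (mod 2),
--   neg π  ≡ fmaj π                                    (mod 2),
-- where the right step from an arc of length n-i has index i.  Hence the
-- weighted sums factor into a q-integer [2n] times Π (1 ± q^(2i-1)).

open import Data.Nat using (ℕ)

-- Equality of polynomials is
-- coefficientwise; we wrap it in a record so that the two polynomials can
-- be inferred from a proof, and package it as a setoid for reasoning.
module PolynomialArithmetic where

  open import Defs
  open import Data.Nat as ℕ using (ℕ; zero; suc)
  open import Data.Integer as ℤ using (ℤ; +_)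
  import Data.Integer.Properties as ℤP
  open import Data.List using ([]; _∷_)
  open import Level using (0ℓ)
  open import Relation.Binary.Bundles using (Setoid)
  open import Relation.Binary.PropositionalEquality
  import Relation.Binary.Reasoning.Setoid as SetoidReasoning
  open import Algebra.Properties.CommutativeSemigroup ℤP.+-commutativeSemigroup
    using () renaming (interchange to ℤ-interchange)

  infix 4 _≋_
  record _≋_ (p r : Poly) : Set where
    constructor mk
    field get : p ≈P r
  open _≋_ public

  ≈refl : ∀ {p} → p ≋ p
  ≈refl = mk λ k → refl

  ≈sym : ∀ {p r} → p ≋ r → r ≋ p
  ≈sym (mk e) = mk λ k → sym (e k)

  ≈trans : ∀ {p r s} → p ≋ r → r ≋ s → p ≋ s
  ≈trans (mk e) (mk f) = mk λ k → trans (e k) (f k)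

  ≡⇒≋ : ∀ {p r} → p ≡ r → p ≋ r
  ≡⇒≋ refl = ≈refl

  ≋-setoid : Setoid 0ℓ 0ℓ
  ≋-setoid = record
    { Carrier = Poly ; _≈_ = _≋_
    ; isEquivalence = record { refl = ≈refl ; sym = ≈sym ; trans = ≈trans } }

  module ≋-Reasoning = SetoidReasoning ≋-setoid

  coeff-⊕ : ∀ p r k → coeff (p ⊕ r) k ≡ coeff p k ℤ.+ coeff r k
  coeff-⊕ []      r       k       = sym (ℤP.+-identityˡ _)
  coeff-⊕ (a ∷ p) []      k       = sym (ℤP.+-identityʳ _)
  coeff-⊕ (a ∷ p) (b ∷ r) zero    = refl
  coeff-⊕ (a ∷ p) (b ∷ r) (suc k) = coeff-⊕ p r k

  coeff-scale : ∀ c p k → coeff (scale c p) k ≡ c ℤ.* coeff p k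
  coeff-scale c []      k       = sym (ℤP.*-zeroʳ c)
  coeff-scale c (a ∷ p) zero    = refl
  coeff-scale c (a ∷ p) (suc k) = coeff-scale c p k

  ⊕-cong : ∀ {p p' r r'} → p ≋ p' → r ≋ r' → p ⊕ r ≋ p' ⊕ r'
  ⊕-cong {p} {p'} {r} {r'} (mk e) (mk f) = mk λ k → begin
      coeff (p ⊕ r) k           ≡⟨ coeff-⊕ p r k ⟩
      coeff p k ℤ.+ coeff r k   ≡⟨ cong₂ ℤ._+_ (e k) (f k) ⟩
      coeff p' k ℤ.+ coeff r' k ≡⟨ coeff-⊕ p' r' k ⟨
      coeff (p' ⊕ r') k         ∎
    where open ≡-Reasoning

  ⊕-comm : ∀ p r → p ⊕ r ≋ r ⊕ p
  ⊕-comm p r = mk λ k →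
    trans (coeff-⊕ p r k) (trans (ℤP.+-comm (coeff p k) _) (sym (coeff-⊕ r p k)))

  ⊕-assoc : ∀ p r s → (p ⊕ r) ⊕ s ≋ p ⊕ (r ⊕ s)
  ⊕-assoc p r s = mk λ k → begin
      coeff ((p ⊕ r) ⊕ s) k                       ≡⟨ coeff-⊕ (p ⊕ r) s k ⟩
      coeff (p ⊕ r) k ℤ.+ coeff s k               ≡⟨ cong (ℤ._+ coeff s k) (coeff-⊕ p r k) ⟩
      (coeff p k ℤ.+ coeff r k) ℤ.+ coeff s k     ≡⟨ ℤP.+-assoc (coeff p k) _ _ ⟩
      coeff p k ℤ.+ (coeff r k ℤ.+ coeff s k)     ≡⟨ cong (λ z → coeff p k ℤ.+ z) (coeff-⊕ r s k) ⟨
      coeff p k ℤ.+ coeff (r ⊕ s) k               ≡⟨ coeff-⊕ p (r ⊕ s) k ⟨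
      coeff (p ⊕ (r ⊕ s)) k                       ∎
    where open ≡-Reasoning

  ⊕-idʳ : ∀ p → p ⊕ [] ≋ p
  ⊕-idʳ p = mk λ k → trans (coeff-⊕ p [] k) (ℤP.+-identityʳ _)

  ⊕-interchange : ∀ a b c d → (a ⊕ b) ⊕ (c ⊕ d) ≋ (a ⊕ c) ⊕ (b ⊕ d)
  ⊕-interchange a b c d = mk λ k → begin
      coeff ((a ⊕ b) ⊕ (c ⊕ d)) k                         ≡⟨ expand a b c d k ⟩
      (coeff a k ℤ.+ coeff b k) ℤ.+ (coeff c k ℤ.+ coeff d k)
        ≡⟨ ℤ-interchange (coeff a k) (coeff b k) (coeff c k) (coeff d k) ⟩
      (coeff a k ℤ.+ coeff c k) ℤ.+ (coeff b k ℤ.+ coeff d k) ≡⟨ expand a c b d k ⟨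
      coeff ((a ⊕ c) ⊕ (b ⊕ d)) k                         ∎
    where
    open ≡-Reasoning
    expand : ∀ w x y z k →
      coeff ((w ⊕ x) ⊕ (y ⊕ z)) k ≡ (coeff w k ℤ.+ coeff x k) ℤ.+ (coeff y k ℤ.+ coeff z k)
    expand w x y z k =
      trans (coeff-⊕ (w ⊕ x) (y ⊕ z) k) (cong₂ ℤ._+_ (coeff-⊕ w x k) (coeff-⊕ y z k))

  scale-cong : ∀ c {p r} → p ≋ r → scale c p ≋ scale c r
  scale-cong c {p} {r} (mk e) = mk λ k →
    trans (coeff-scale c p k) (trans (cong (c ℤ.*_) (e k)) (sym (coeff-scale c r k)))

  scale-⊕ : ∀ c p r → scale c (p ⊕ r) ≋ scale c p ⊕ scale c r
  scale-⊕ c p r = mk λ k → begin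
      coeff (scale c (p ⊕ r)) k                  ≡⟨ coeff-scale c (p ⊕ r) k ⟩
      c ℤ.* coeff (p ⊕ r) k                      ≡⟨ cong (c ℤ.*_) (coeff-⊕ p r k) ⟩
      c ℤ.* (coeff p k ℤ.+ coeff r k)            ≡⟨ ℤP.*-distribˡ-+ c _ _ ⟩
      c ℤ.* coeff p k ℤ.+ c ℤ.* coeff r k        ≡⟨ cong₂ ℤ._+_ (coeff-scale c p k) (coeff-scale c r k) ⟨
      coeff (scale c p) k ℤ.+ coeff (scale c r) k ≡⟨ coeff-⊕ (scale c p) (scale c r) k ⟨
      coeff (scale c p ⊕ scale c r) k            ∎
    where open ≡-Reasoning

  scale-+ : ∀ a b p → scale (a ℤ.+ b) p ≋ scale a p ⊕ scale b p
  scale-+ a b p = mk λ k → begin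
      coeff (scale (a ℤ.+ b) p) k                ≡⟨ coeff-scale (a ℤ.+ b) p k ⟩
      (a ℤ.+ b) ℤ.* coeff p k                    ≡⟨ ℤP.*-distribʳ-+ (coeff p k) a b ⟩
      a ℤ.* coeff p k ℤ.+ b ℤ.* coeff p k        ≡⟨ cong₂ ℤ._+_ (coeff-scale a p k) (coeff-scale b p k) ⟨
      coeff (scale a p) k ℤ.+ coeff (scale b p) k ≡⟨ coeff-⊕ (scale a p) (scale b p) k ⟨
      coeff (scale a p ⊕ scale b p) k            ∎
    where open ≡-Reasoning

  scale-zero : ∀ p → scale (+ 0) p ≋ []
  scale-zero p = mk (coeff-scale (+ 0) p)

  scale-one : ∀ p → scale (+ 1) p ≋ p
  scale-one p = mk λ k → trans (coeff-scale (+ 1) p k) (ℤP.*-identityˡ _)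

  shiftq-⊕ : ∀ p r → (+ 0 ∷ p) ⊕ (+ 0 ∷ r) ≋ + 0 ∷ (p ⊕ r)
  shiftq-⊕ p r = mk λ { zero → refl ; (suc k) → refl }

  shiftq-cong : ∀ {p r} → p ≋ r → (+ 0 ∷ p) ≋ (+ 0 ∷ r)
  shiftq-cong (mk e) = mk λ { zero → refl ; (suc k) → e k }

  shiftq-nil : ∀ {p} → p ≋ [] → (+ 0 ∷ p) ≋ []
  shiftq-nil (mk e) = mk λ { zero → refl ; (suc k) → e k }

  ⊗-zeroˡ : ∀ {p} r → p ≋ [] → p ⊗ r ≋ []
  ⊗-zeroˡ {[]}    r e      = ≈refl
  ⊗-zeroˡ {a ∷ p} r (mk e) =
    ⊕-cong {scale a r} {[]} {_} {[]} (mk λ k → trans (coeff-scale a r k) (cong (ℤ._* coeff r k) (e 0)))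
           (shiftq-nil (⊗-zeroˡ {p} r (mk λ k → e (suc k))))

  ⊗-congˡ : ∀ {p p'} r → p ≋ p' → p ⊗ r ≋ p' ⊗ r
  ⊗-congˡ {[]}    {p'}     r e = ≈sym (⊗-zeroˡ r (≈sym e))
  ⊗-congˡ {a ∷ p} {[]}     r e = ⊗-zeroˡ r e
  ⊗-congˡ {a ∷ p} {b ∷ p'} r (mk e) rewrite e 0 =
    ⊕-cong (≈refl {scale b r}) (shiftq-cong (⊗-congˡ {p} {p'} r (mk λ k → e (suc k))))

  ⊗-congʳ : ∀ p {r r'} → r ≋ r' → p ⊗ r ≋ p ⊗ r'
  ⊗-congʳ []      e = ≈refl
  ⊗-congʳ (a ∷ p) e = ⊕-cong (scale-cong a e) (shiftq-cong (⊗-congʳ p e))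

  ⊗-cong : ∀ {p p' r r'} → p ≋ p' → r ≋ r' → p ⊗ r ≋ p' ⊗ r'
  ⊗-cong {p} {p'} {r} e f = ≈trans (⊗-congˡ r e) (⊗-congʳ p' f)

  ⊗-distribˡ : ∀ p r s → p ⊗ (r ⊕ s) ≋ p ⊗ r ⊕ p ⊗ s
  ⊗-distribˡ []      r s = ≈refl
  ⊗-distribˡ (a ∷ p) r s = begin
      scale a (r ⊕ s) ⊕ (+ 0 ∷ p ⊗ (r ⊕ s))
        ≈⟨ ⊕-cong (scale-⊕ a r s) (shiftq-cong (⊗-distribˡ p r s)) ⟩
      (scale a r ⊕ scale a s) ⊕ (+ 0 ∷ (p ⊗ r ⊕ p ⊗ s))
        ≈⟨ ⊕-cong (≈refl {scale a r ⊕ scale a s}) (shiftq-⊕ (p ⊗ r) (p ⊗ s)) ⟨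
      (scale a r ⊕ scale a s) ⊕ ((+ 0 ∷ p ⊗ r) ⊕ (+ 0 ∷ p ⊗ s))
        ≈⟨ ⊕-interchange (scale a r) (scale a s) (+ 0 ∷ p ⊗ r) (+ 0 ∷ p ⊗ s) ⟩
      (scale a r ⊕ (+ 0 ∷ p ⊗ r)) ⊕ (scale a s ⊕ (+ 0 ∷ p ⊗ s)) ∎
    where open ≋-Reasoning

  ⊗-distribʳ : ∀ p r s → (p ⊕ r) ⊗ s ≋ p ⊗ s ⊕ r ⊗ s
  ⊗-distribʳ []      r       s = ≈refl
  ⊗-distribʳ (a ∷ p) []      s = ≈sym (⊕-idʳ _)
  ⊗-distribʳ (a ∷ p) (b ∷ r) s = begin
      scale (a ℤ.+ b) s ⊕ (+ 0 ∷ (p ⊕ r) ⊗ s)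
        ≈⟨ ⊕-cong (scale-+ a b s) (shiftq-cong (⊗-distribʳ p r s)) ⟩
      (scale a s ⊕ scale b s) ⊕ (+ 0 ∷ (p ⊗ s ⊕ r ⊗ s))
        ≈⟨ ⊕-cong (≈refl {scale a s ⊕ scale b s}) (shiftq-⊕ (p ⊗ s) (r ⊗ s)) ⟨
      (scale a s ⊕ scale b s) ⊕ ((+ 0 ∷ p ⊗ s) ⊕ (+ 0 ∷ r ⊗ s))
        ≈⟨ ⊕-interchange (scale a s) (scale b s) (+ 0 ∷ p ⊗ s) (+ 0 ∷ r ⊗ s) ⟩
      (scale a s ⊕ (+ 0 ∷ p ⊗ s)) ⊕ (scale b s ⊕ (+ 0 ∷ r ⊗ s)) ∎
    where open ≋-Reasoning

  oneP-⊗ : ∀ r → oneP ⊗ r ≋ r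
  oneP-⊗ r = ≈trans (⊕-cong (scale-one r) (shiftq-nil ≈refl)) (⊕-idʳ r)

  scale-mono : ∀ a b j → scale a (monoP b j) ≋ monoP (a ℤ.* b) j
  scale-mono a b zero    = ≈refl
  scale-mono a b (suc j) = mk λ { zero → ℤP.*-zeroʳ a ; (suc k) → get (scale-mono a b j) k }

  mono-⊗ : ∀ a i b j → monoP a i ⊗ monoP b j ≋ monoP (a ℤ.* b) (i ℕ.+ j)
  mono-⊗ a zero    b j = ≈trans (⊕-cong (scale-mono a b j) (shiftq-nil ≈refl))
                                (⊕-idʳ _)
  mono-⊗ a (suc i) b j = ≈trans (⊕-cong (scale-zero (monoP b j)) ≈refl) (shiftq-cong (mono-⊗ a i b j))

  mono-cong : ∀ {a b i j} → a ≡ b → i ≡ j → monoP a i ≋ monoP b j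
  mono-cong refl refl = ≈refl

-- The Boolean comparisons of ℕ used by the definitions, turned into
-- equations with true/false so that they can be used with rewrite.
module Comparisons where

  open import Data.Bool using (true; false; _∨_; T)
  open import Data.Nat using (_<_; _≤_; _<ᵇ_; _≤ᵇ_; _≡ᵇ_; _<?_)
  import Data.Nat.Properties as ℕP
  open import Data.Product using (_×_; _,_)
  open import Data.Sum using (_⊎_; inj₁; inj₂)
  open import Data.Empty using (⊥-elim)
  open import Data.Unit using (tt)
  open import Relation.Nullary using (¬_; yes; no)
  open import Relation.Binary.PropositionalEquality

  T⇒≡true : ∀ {b} → T b → b ≡ true
  T⇒≡true {true} _ = refl

  ≡true⇒T : ∀ {b} → b ≡ true → T b
  ≡true⇒T refl = tt

  false≢true : false ≢ true
  false≢true ()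

  <ᵇ-t : ∀ {a b} → a < b → (a <ᵇ b) ≡ true
  <ᵇ-t lt = T⇒≡true (ℕP.<⇒<ᵇ lt)

  <ᵇ⇒< : ∀ {a b} → (a <ᵇ b) ≡ true → a < b
  <ᵇ⇒< {a} {b} e = ℕP.<ᵇ⇒< a b (≡true⇒T e)

  <ᵇ-f : ∀ {a b} → b ≤ a → (a <ᵇ b) ≡ false
  <ᵇ-f {a} {b} le with a <ᵇ b in eq
  ... | false = refl
  ... | true  = ⊥-elim (ℕP.<⇒≱ (<ᵇ⇒< eq) le)

  <ᵇ⇒≥ : ∀ {a b} → (a <ᵇ b) ≡ false → b ≤ a
  <ᵇ⇒≥ {a} {b} e = ℕP.≮⇒≥ (λ lt → false≢true (trans (sym e) (<ᵇ-t lt)))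

  <ᵇ-dec : ∀ a b → (a < b × (a <ᵇ b) ≡ true) ⊎ (b ≤ a × (a <ᵇ b) ≡ false)
  <ᵇ-dec a b with a <? b
  ... | yes lt = inj₁ (lt , <ᵇ-t lt)
  ... | no ¬lt = inj₂ (ℕP.≮⇒≥ ¬lt , <ᵇ-f (ℕP.≮⇒≥ ¬lt))

  ≤ᵇ-t : ∀ {a b} → a ≤ b → (a ≤ᵇ b) ≡ true
  ≤ᵇ-t le = T⇒≡true (ℕP.≤⇒≤ᵇ le)

  ≤ᵇ-f : ∀ {a b} → b < a → (a ≤ᵇ b) ≡ false
  ≤ᵇ-f {a} {b} lt with a ≤ᵇ b in eq
  ... | false = refl
  ... | true  = ⊥-elim (ℕP.<⇒≱ lt (ℕP.≤ᵇ⇒≤ a b (≡true⇒T eq)))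

  ≡ᵇ-t : ∀ {a b} → a ≡ b → (a ≡ᵇ b) ≡ true
  ≡ᵇ-t {a} {b} e = T⇒≡true (ℕP.≡⇒≡ᵇ a b e)

  ≡ᵇ-≡ : ∀ {a b} → (a ≡ᵇ b) ≡ true → a ≡ b
  ≡ᵇ-≡ {a} {b} e = ℕP.≡ᵇ⇒≡ a b (≡true⇒T e)

  ≡ᵇ-f : ∀ {a b} → ¬ (a ≡ b) → (a ≡ᵇ b) ≡ false
  ≡ᵇ-f {a} {b} ne with a ≡ᵇ b in eq
  ... | false = refl
  ... | true  = ⊥-elim (ne (≡ᵇ-≡ eq))

  ∨-false : ∀ {a b} → a ≡ false → b ≡ false → (a ∨ b) ≡ false
  ∨-false refl refl = refl

  ∨-trueˡ : ∀ {a} b → a ≡ true → (a ∨ b) ≡ true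
  ∨-trueˡ b refl = refl

  ∨-trueʳ : ∀ a {b} → b ≡ true → (a ∨ b) ≡ true
  ∨-trueʳ true  refl = refl
  ∨-trueʳ false refl = refl

module FiniteSums where

  open import Defs
  open PolynomialArithmetic
  open Comparisons
  open import Data.Bool using (Bool; true; false; if_then_else_; _∨_; T?)
  open import Data.Nat using (ℕ; zero; suc; _<_; _+_; _∸_; _≡ᵇ_; s≤s; z≤n)
  open import Data.List using (List; []; _∷_; map; filter; concatMap; concat; _++_; applyUpTo; upTo; length)
  import Data.List.Properties as LP
  open import Relation.Nullary using (¬_)
  open import Relation.Binary.PropositionalEquality
  open import Function using (_∘_)

  ΣL : {A : Set} → List A → (A → Poly) → Poly
  ΣL xs f = sumP (map f xs)

  ΣL-cong : {A : Set} (xs : List A) {f g : A → Poly} → (∀ x → f x ≋ g x) → ΣL xs f ≋ ΣL xs g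
  ΣL-cong []       e = ≈refl
  ΣL-cong (x ∷ xs) e = ⊕-cong (e x) (ΣL-cong xs e)

  ΣL-zero : {A : Set} (xs : List A) → ΣL xs (λ _ → []) ≋ []
  ΣL-zero []       = ≈refl
  ΣL-zero (x ∷ xs) = ΣL-zero xs

  ΣL-++ : {A : Set} (xs ys : List A) (f : A → Poly) → ΣL (xs ++ ys) f ≋ ΣL xs f ⊕ ΣL ys f
  ΣL-++ []       ys f = ≈refl
  ΣL-++ (x ∷ xs) ys f =
    ≈trans (⊕-cong (≈refl {f x}) (ΣL-++ xs ys f)) (≈sym (⊕-assoc (f x) (ΣL xs f) (ΣL ys f)))

  ΣL-map : {A B : Set} (g : A → B) (xs : List A) (f : B → Poly) → ΣL (map g xs) f ≡ ΣL xs (f ∘ g)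
  ΣL-map g xs f = cong sumP (sym (LP.map-∘ xs))

  ΣL-concatMap : {A B : Set} (g : A → List B) (xs : List A) (f : B → Poly) →
    ΣL (concatMap g xs) f ≋ ΣL xs (λ x → ΣL (g x) f)
  ΣL-concatMap g []       f = ≈refl
  ΣL-concatMap g (x ∷ xs) f =
    ≈trans (ΣL-++ (g x) (concat (map g xs)) f) (⊕-cong (≈refl {ΣL (g x) f}) (ΣL-concatMap g xs f))

  ΣL-⊕ : {A : Set} (xs : List A) (f g : A → Poly) → ΣL xs (λ x → f x ⊕ g x) ≋ ΣL xs f ⊕ ΣL xs g
  ΣL-⊕ []       f g = ≈refl
  ΣL-⊕ (x ∷ xs) f g = ≈trans (⊕-cong (≈refl {f x ⊕ g x}) (ΣL-⊕ xs f g))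
                             (⊕-interchange (f x) (g x) (ΣL xs f) (ΣL xs g))

  ΣL-swap : {A B : Set} (xs : List A) (ys : List B) (F : A → B → Poly) →
    ΣL xs (λ x → ΣL ys (F x)) ≋ ΣL ys (λ y → ΣL xs (λ x → F x y))
  ΣL-swap []       ys F = ≈sym (ΣL-zero ys)
  ΣL-swap (x ∷ xs) ys F = ≈trans (⊕-cong (≈refl {ΣL ys (F x)}) (ΣL-swap xs ys F))
                                 (≈sym (ΣL-⊕ ys (F x) (λ y → ΣL xs (λ x → F x y))))

  onlyIf : Bool → Poly → Poly
  onlyIf b p = if b then p else []

  onlyIf-∧ : ∀ a b p → onlyIf a (onlyIf b p) ≡ onlyIf (a Data.Bool.∧ b) p
  onlyIf-∧ true  b p = refl
  onlyIf-∧ false b p = refl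

  ΣL-onlyIf : {B : Set} (xs : List B) (b : Bool) (f : B → Poly) →
    ΣL xs (λ x → onlyIf b (f x)) ≋ onlyIf b (ΣL xs f)
  ΣL-onlyIf xs true  f = ≈refl
  ΣL-onlyIf xs false f = ΣL-zero xs

  ΣL-filter : {A : Set} (P : A → Bool) (xs : List A) (f : A → Poly) →
    ΣL (filter (λ x → T? (P x)) xs) f ≋ ΣL xs (λ x → onlyIf (P x) (f x))
  ΣL-filter P []       f = ≈refl
  ΣL-filter P (x ∷ xs) f with P x
  ... | true  = ⊕-cong (≈refl {f x}) (ΣL-filter P xs f)
  ... | false = ΣL-filter P xs f

  Σ< : ℕ → (ℕ → Poly) → Poly
  Σ< m f = sumP (applyUpTo f m)

  ΣL-upTo : (m : ℕ) (f : ℕ → Poly) → ΣL (upTo m) f ≡ Σ< m f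
  ΣL-upTo m f = cong sumP (LP.map-upTo f m)

  Σ<-cong : ∀ m {f g : ℕ → Poly} → (∀ p → p < m → f p ≋ g p) → Σ< m f ≋ Σ< m g
  Σ<-cong zero    e = ≈refl
  Σ<-cong (suc m) e = ⊕-cong (e 0 (s≤s z≤n)) (Σ<-cong m (λ p lt → e (suc p) (s≤s lt)))

  Σ<-zero : ∀ m → Σ< m (λ _ → []) ≋ []
  Σ<-zero zero    = ≈refl
  Σ<-zero (suc m) = Σ<-zero m

  Σ<-⊕ : ∀ m (f g : ℕ → Poly) → Σ< m (λ x → f x ⊕ g x) ≋ Σ< m f ⊕ Σ< m g
  Σ<-⊕ zero    f g = ≈refl
  Σ<-⊕ (suc m) f g = ≈trans (⊕-cong (≈refl {f 0 ⊕ g 0}) (Σ<-⊕ m (f ∘ suc) (g ∘ suc)))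
                            (⊕-interchange (f 0) (g 0) (Σ< m (f ∘ suc)) (Σ< m (g ∘ suc)))

  Σ<-split : ∀ a b (g : ℕ → Poly) → Σ< (a + b) g ≋ Σ< a g ⊕ Σ< b (λ i → g (a + i))
  Σ<-split zero    b g = ≈refl
  Σ<-split (suc a) b g = ≈trans (⊕-cong (≈refl {g 0}) (Σ<-split a b (g ∘ suc)))
    (≈sym (⊕-assoc (g 0) (Σ< a (g ∘ suc)) (Σ< b (λ i → g (suc a + i)))))

  Σ<-snoc : ∀ m (f : ℕ → Poly) → Σ< (suc m) f ≋ Σ< m f ⊕ f m
  Σ<-snoc zero    f = ⊕-idʳ (f 0)
  Σ<-snoc (suc m) f = ≈trans (⊕-cong (≈refl {f 0}) (Σ<-snoc m (f ∘ suc)))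
                             (≈sym (⊕-assoc (f 0) (Σ< m (f ∘ suc)) (f (suc m))))

  Σ<-rev : ∀ m (f : ℕ → Poly) → Σ< m (λ p → f (m ∸ suc p)) ≋ Σ< m f
  Σ<-rev zero    f = ≈refl
  Σ<-rev (suc m) f = ≈trans (⊕-cong (≈refl {f m}) (Σ<-rev m f))
                            (≈trans (⊕-comm (f m) (Σ< m f)) (≈sym (Σ<-snoc m f)))

  Σ<-⊗ʳ : ∀ m (f : ℕ → Poly) (r : Poly) → Σ< m f ⊗ r ≋ Σ< m (λ x → f x ⊗ r)
  Σ<-⊗ʳ zero    f r = ≈refl
  Σ<-⊗ʳ (suc m) f r = ≈trans (⊗-distribʳ (f 0) (Σ< m (f ∘ suc)) r)
                             (⊕-cong (≈refl {f 0 ⊗ r}) (Σ<-⊗ʳ m (f ∘ suc) r))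

  Σ<-point : ∀ m a (F : ℕ → Poly) → a < m → Σ< m (λ p → onlyIf (p ≡ᵇ a) (F p)) ≋ F a
  Σ<-point (suc m) zero    F lt       = ≈trans (⊕-cong (≈refl {F 0}) (Σ<-zero m)) (⊕-idʳ (F 0))
  Σ<-point (suc m) (suc a) F (s≤s lt) = Σ<-point m a (F ∘ suc) lt

  Σ<-two-points : ∀ m a b (G : ℕ → Poly) → a < m → b < m → ¬ (a ≡ b) →
    Σ< m (λ q → onlyIf ((q ≡ᵇ a) ∨ (q ≡ᵇ b)) (G q)) ≋ G a ⊕ G b
  Σ<-two-points m a b G a<m b<m a≢b =
    ≈trans (Σ<-cong m (λ q _ → split q))
      (≈trans (Σ<-⊕ m (λ q → onlyIf (q ≡ᵇ a) (G q)) (λ q → onlyIf (q ≡ᵇ b) (G q)))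
              (⊕-cong (Σ<-point m a G a<m) (Σ<-point m b G b<m)))
    where
    split : ∀ q → onlyIf ((q ≡ᵇ a) ∨ (q ≡ᵇ b)) (G q) ≋ onlyIf (q ≡ᵇ a) (G q) ⊕ onlyIf (q ≡ᵇ b) (G q)
    split q with q ≡ᵇ a in q≡a
    ... | false = ≈refl
    ... | true rewrite ≡ᵇ-f {q} {b} (λ q≡b → a≢b (trans (sym (≡ᵇ-≡ q≡a)) q≡b)) = ≈sym (⊕-idʳ (G q))

  ΣBits : ℕ → (List Bool → Poly) → Poly
  ΣBits zero    h = h []
  ΣBits (suc j) h = ΣBits j (λ e → h (false ∷ e) ⊕ h (true ∷ e))

  ΣBits-cong : ∀ j {h g : List Bool → Poly} → (∀ e → length e ≡ j → h e ≋ g e) → ΣBits j h ≋ ΣBits j g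
  ΣBits-cong zero    e = e [] refl
  ΣBits-cong (suc j) e =
    ΣBits-cong j (λ x lx → ⊕-cong (e (false ∷ x) (cong suc lx)) (e (true ∷ x) (cong suc lx)))

  ΣBits-⊕ : ∀ j (f g : List Bool → Poly) → ΣBits j (λ x → f x ⊕ g x) ≋ ΣBits j f ⊕ ΣBits j g
  ΣBits-⊕ zero    f g = ≈refl
  ΣBits-⊕ (suc j) f g =
    ≈trans (ΣBits-cong j (λ x _ → ⊕-interchange (f (false ∷ x)) (g (false ∷ x)) (f (true ∷ x)) (g (true ∷ x))))
           (ΣBits-⊕ j (λ x → f (false ∷ x) ⊕ f (true ∷ x)) (λ x → g (false ∷ x) ⊕ g (true ∷ x)))

  ΣBits-⊗ˡ : ∀ j (f : List Bool → Poly) (r : Poly) → r ⊗ ΣBits j f ≋ ΣBits j (λ x → r ⊗ f x)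
  ΣBits-⊗ˡ zero    f r = ≈refl
  ΣBits-⊗ˡ (suc j) f r =
    ≈trans (ΣBits-⊗ˡ j (λ e → f (false ∷ e) ⊕ f (true ∷ e)) r)
           (ΣBits-cong j (λ x _ → ⊗-distribˡ r (f (false ∷ x)) (f (true ∷ x))))

  ΣBits-head : ∀ j (h : List Bool → Poly) →
    ΣBits (suc j) h ≋ ΣBits j (λ e → h (false ∷ e)) ⊕ ΣBits j (λ e → h (true ∷ e))
  ΣBits-head j h = ΣBits-⊕ j (λ e → h (false ∷ e)) (λ e → h (true ∷ e))

-- The arc of length k starting at t is
-- the set of p with  cdist m t p < k.
module CyclicArithmetic (m' : ℕ) where

  open import Defs using (cdist)
  open Comparisons
  open import Data.Bool using (true; false; _∨_)
  open import Data.Nat as ℕ using (ℕ; zero; suc; _<_; _≤_; _∸_; _+_; s≤s; _<ᵇ_; _≡ᵇ_; _%_)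
  import Data.Nat.Properties as ℕP
  open import Data.Nat.DivMod
  open import Data.Sum using (_⊎_; inj₁; inj₂)
  open import Data.Product using (_,_)
  open import Data.Empty using (⊥-elim)
  open import Relation.Binary.PropositionalEquality
  open import Relation.Binary.Definitions using (tri<; tri≈; tri>)
  open import Relation.Nullary using (¬_; yes; no)

  m : ℕ
  m = suc m'

  m-1<m : m ∸ 1 < m
  m-1<m = ℕP.≤-refl

  shift : ℕ → ℕ → ℕ
  shift t d = (t + d) % m

  shift<m : ∀ t d → shift t d < m
  shift<m t d = m%n<n (t + d) m

  %-wrap : ∀ x → m ≤ x → x < m + m → x % m ≡ x ∸ m
  %-wrap x m≤x x<2m = begin
      x % m           ≡⟨ cong (_% m) (ℕP.m∸n+n≡m m≤x) ⟨
      (x ∸ m + m) % m ≡⟨ [m+n]%n≡m%n (x ∸ m) m ⟩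
      (x ∸ m) % m     ≡⟨ m<n⇒m%n≡m (ℕP.m<n+o⇒m∸n<o x m x<2m) ⟩
      x ∸ m           ∎
    where open ≡-Reasoning

  wrapped<start : ∀ t d → d < m → m ≤ t + d → t + d ∸ m < t
  wrapped<start zero      d d<m m≤d = ⊥-elim (ℕP.<⇒≱ d<m m≤d)
  wrapped<start t@(suc _) d d<m _   =
    ℕP.m<n+o⇒m∸n<o (t + d) m (subst (t + d <_) (ℕP.+-comm t m) (ℕP.+-monoʳ-< t d<m))

  cdist-shift : ∀ t d → t < m → d < m → cdist m t (shift t d) ≡ d
  cdist-shift t d t<m d<m with <ᵇ-dec (t + d) m
  ... | inj₁ (lt , _) rewrite m<n⇒m%n≡m lt | ≤ᵇ-t (ℕP.m≤m+n t d) = ℕP.m+n∸m≡n t d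
  ... | inj₂ (ge , _) rewrite %-wrap (t + d) ge (ℕP.+-mono-< t<m d<m)
                            | ≤ᵇ-f (wrapped<start t d d<m ge) | ℕP.m∸n+n≡m ge = ℕP.m+n∸m≡n t d

  shift-cdist : ∀ t p → t < m → p < m → shift t (cdist m t p) ≡ p
  shift-cdist t p t<m p<m with <ᵇ-dec p t
  ... | inj₂ (t≤p , _) rewrite ≤ᵇ-t t≤p | ℕP.m+[n∸m]≡n t≤p = m<n⇒m%n≡m p<m
  ... | inj₁ (p<t , _) rewrite ≤ᵇ-f p<t
                             | ℕP.m+[n∸m]≡n (ℕP.≤-trans (ℕP.<⇒≤ t<m) (ℕP.m≤n+m m p)) =
    trans ([m+n]%n≡m%n p m) (m<n⇒m%n≡m p<m)

  cdist<m : ∀ t p → t < m → p < m → cdist m t p < m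
  cdist<m t p t<m p<m with <ᵇ-dec p t
  ... | inj₂ (t≤p , _) rewrite ≤ᵇ-t t≤p = ℕP.≤-<-trans (ℕP.m∸n≤m p t) p<m
  ... | inj₁ (p<t , _) rewrite ≤ᵇ-f p<t = ℕP.m<n+o⇒m∸n<o (p + m) t (ℕP.+-monoˡ-< m p<t)

  cdist-self : ∀ t → cdist m t t ≡ 0
  cdist-self t rewrite ≤ᵇ-t (ℕP.≤-refl {t}) = ℕP.n∸n≡0 t

  shift-assoc : ∀ t a b → shift (shift t a) b ≡ shift t (a + b)
  shift-assoc t a b = begin
      ((t + a) % m + b) % m         ≡⟨ %-distribˡ-+ ((t + a) % m) b m ⟩
      ((t + a) % m % m + b % m) % m ≡⟨ cong (λ z → (z + b % m) % m) (m%n%n≡m%n (t + a) m) ⟩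
      ((t + a) % m + b % m) % m     ≡⟨ %-distribˡ-+ (t + a) b m ⟨
      (t + a + b) % m               ≡⟨ cong (_% m) (ℕP.+-assoc t a b) ⟩
      (t + (a + b)) % m             ∎
    where open ≡-Reasoning

  shift-m : ∀ t a → shift t (a + m) ≡ shift t a
  shift-m t a = trans (cong (_% m) (sym (ℕP.+-assoc t a m))) ([m+n]%n≡m%n (t + a) m)

  shift-zero : ∀ t → t < m → shift t 0 ≡ t
  shift-zero t t<m = trans (cong (_% m) (ℕP.+-identityʳ t)) (m<n⇒m%n≡m t<m)

  shift-back-forward : ∀ t → t < m → shift (shift t (m ∸ 1)) 1 ≡ t
  shift-back-forward t t<m = begin
      shift (shift t (m ∸ 1)) 1 ≡⟨ shift-assoc t (m ∸ 1) 1 ⟩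
      shift t (m ∸ 1 + 1)       ≡⟨ cong (shift t) (ℕP.+-comm (m ∸ 1) 1) ⟩
      shift t (0 + m)           ≡⟨ shift-m t 0 ⟩
      shift t 0                 ≡⟨ shift-zero t t<m ⟩
      t                         ∎
    where open ≡-Reasoning

  cdist-back : ∀ t → t < m → cdist m t (shift t (m ∸ 1)) ≡ m ∸ 1
  cdist-back t t<m = cdist-shift t (m ∸ 1) t<m m-1<m

  arc-extendˡ : ∀ t k p → t < m → p < m →
    ((p ≡ᵇ shift t (m ∸ 1)) ∨ (cdist m t p <ᵇ k)) ≡ (cdist m (shift t (m ∸ 1)) p <ᵇ suc k)
  arc-extendˡ t k p t<m p<m with ℕP.m≤n⇒m<n∨m≡n (ℕP.<⇒≤pred (cdist<m t p t<m p<m))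
  ... | inj₂ d≡m-1 = atNeighbour (trans (sym (shift-cdist t p t<m p<m)) (cong (shift t) d≡m-1))
    where
    atNeighbour : p ≡ shift t (m ∸ 1) →
      ((p ≡ᵇ shift t (m ∸ 1)) ∨ (cdist m t p <ᵇ k)) ≡ (cdist m (shift t (m ∸ 1)) p <ᵇ suc k)
    atNeighbour p≡ rewrite ≡ᵇ-t p≡ | sym p≡ | cdist-self p = refl
  ... | inj₁ d<m-1 = begin
      (p ≡ᵇ qL) ∨ (d <ᵇ k)          ≡⟨ cong (_∨ (d <ᵇ k)) (≡ᵇ-f p≢qL) ⟩
      d <ᵇ k                        ≡⟨⟩
      suc d <ᵇ suc k                ≡⟨ cong (_<ᵇ suc k) (cdist-shift qL (suc d) (shift<m t (m ∸ 1)) (s≤s d<m-1)) ⟨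
      cdist m qL (shift qL (suc d)) <ᵇ suc k ≡⟨ cong (λ z → cdist m qL z <ᵇ suc k) p≡ ⟩
      cdist m qL p <ᵇ suc k         ∎
    where
    open ≡-Reasoning
    d  = cdist m t p
    qL = shift t (m ∸ 1)
    p≢qL : ¬ (p ≡ qL)
    p≢qL eq = ℕP.<⇒≢ d<m-1 (trans (cong (cdist m t) eq) (cdist-back t t<m))
    p≡ : shift qL (suc d) ≡ p
    p≡ = begin
      shift qL (suc d)        ≡⟨ shift-assoc t (m ∸ 1) (suc d) ⟩
      shift t (m ∸ 1 + suc d) ≡⟨ cong (shift t) (trans (ℕP.+-comm (m ∸ 1) (suc d)) (sym (ℕP.+-suc d (m ∸ 1)))) ⟩
      shift t (d + m)         ≡⟨ shift-m t d ⟩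
      shift t d               ≡⟨ shift-cdist t p t<m p<m ⟩
      p                       ∎

  arc-extendʳ : ∀ t k p → t < m → k < m → p < m →
    ((p ≡ᵇ shift t k) ∨ (cdist m t p <ᵇ k)) ≡ (cdist m t p <ᵇ suc k)
  arc-extendʳ t k p t<m k<m p<m with ℕP.<-cmp (cdist m t p) k
  ... | tri< lt _ _ = trans (∨-trueʳ (p ≡ᵇ shift t k) (<ᵇ-t lt)) (sym (<ᵇ-t (ℕP.m<n⇒m<1+n lt)))
  ... | tri≈ _ eq _ =
    trans (∨-trueˡ (cdist m t p <ᵇ k) (≡ᵇ-t (trans (sym (shift-cdist t p t<m p<m)) (cong (shift t) eq))))
          (sym (<ᵇ-t (subst (_< suc k) (sym eq) ℕP.≤-refl)))
  ... | tri> _ _ gt = trans (∨-false (≡ᵇ-f p≢) (<ᵇ-f (ℕP.<⇒≤ gt))) (sym (<ᵇ-f gt))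
    where
    p≢ : ¬ (p ≡ shift t k)
    p≢ eq = ℕP.<⇒≢ gt (sym (trans (cong (cdist m t) eq) (cdist-shift t k t<m k<m)))

  arc-start : ∀ s t k → s < m → t < m → suc k < m →
    (cdist m s t <ᵇ suc k) ≡ true → (cdist m s (shift t (m ∸ 1)) <ᵇ suc k) ≡ false → s ≡ t
  arc-start s t k s<m t<m sk<m t∈ qL∉ =
    byCases (ℕP.m≤n⇒m<n∨m≡n (subst (_≤ m) (ℕP.+-comm 1 d) d<m))
    where
    qL = shift t (m ∸ 1)
    d  = cdist m s qL
    d<m : d < m
    d<m = cdist<m s qL s<m (shift<m t (m ∸ 1))
    t≡ : t ≡ shift s (d + 1)
    t≡ = begin
      t                   ≡⟨ shift-back-forward t t<m ⟨
      shift qL 1          ≡⟨ cong (λ z → shift z 1) (shift-cdist s qL s<m (shift<m t (m ∸ 1))) ⟨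
      shift (shift s d) 1 ≡⟨ shift-assoc s d 1 ⟩
      shift s (d + 1)     ∎
      where open ≡-Reasoning
    byCases : d + 1 < m ⊎ d + 1 ≡ m → s ≡ t
    byCases (inj₁ d+1<m) = ⊥-elim (ℕP.<⇒≱ (<ᵇ⇒< t∈)
      (subst (suc k ≤_) (sym (trans (cong (cdist m s) t≡) (cdist-shift s (d + 1) s<m d+1<m)))
             (ℕP.≤-trans (<ᵇ⇒≥ qL∉) (ℕP.m≤m+n d 1))))
    byCases (inj₂ d+1≡m) =
      sym (trans t≡ (trans (cong (shift s) d+1≡m) (trans (shift-m s 0) (shift-zero s s<m))))

  arc-extension-unique : ∀ t s k q → t < m → s < m → q < m → 1 ≤ k → suc k < m → k ≤ cdist m t q →
    (∀ p → p < m → ((p ≡ᵇ q) ∨ (cdist m t p <ᵇ k)) ≡ (cdist m s p <ᵇ suc k)) →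
    q ≡ shift t (m ∸ 1) ⊎ q ≡ shift t k
  arc-extension-unique t s k q t<m s<m q<m 1≤k sk<m k≤dq sameArc
    with q ℕ.≟ shift t (m ∸ 1) | q ℕ.≟ shift t k
  ... | yes q≡qL | _        = inj₁ q≡qL
  ... | no _     | yes q≡qR = inj₂ q≡qR
  ... | no q≢qL  | no q≢qR  = ⊥-elim (q≢qR (sym (≡ᵇ-≡ qR≡q)))
    where
    k<m : k < m
    k<m = ℕP.<-trans (ℕP.n<1+n k) sk<m
    qL = shift t (m ∸ 1)
    qR = shift t k
    t∈ : (cdist m s t <ᵇ suc k) ≡ true
    t∈ = trans (sym (sameArc t t<m))
               (trans (cong (λ z → (t ≡ᵇ q) ∨ (z <ᵇ k)) (cdist-self t)) (∨-trueʳ (t ≡ᵇ q) (<ᵇ-t 1≤k)))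
    qL∉ : (cdist m s qL <ᵇ suc k) ≡ false
    qL∉ = trans (sym (sameArc qL (shift<m t (m ∸ 1))))
      (∨-false (≡ᵇ-f (λ e → q≢qL (sym e)))
               (<ᵇ-f (subst (k ≤_) (sym (cdist-back t t<m)) (ℕP.<⇒≤pred k<m))))
    qR∉old : (cdist m t qR <ᵇ k) ≡ false
    qR∉old = trans (cong (_<ᵇ k) (cdist-shift t k t<m k<m)) (<ᵇ-f (ℕP.≤-refl {k}))
    qR∈new : ((qR ≡ᵇ q) ∨ (cdist m t qR <ᵇ k)) ≡ true
    qR∈new = trans (sameArc qR (shift<m t k))
      (trans (cong (λ z → cdist m z qR <ᵇ suc k) (arc-start s t k s<m t<m sk<m t∈ qL∉))
             (trans (cong (_<ᵇ suc k) (cdist-shift t k t<m k<m)) (<ᵇ-t (ℕP.n<1+n k))))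
    qR≡q : (qR ≡ᵇ q) ≡ true
    qR≡q = leftDisjunct qR∈new
      where
      leftDisjunct : ∀ {b} → (b ∨ (cdist m t qR <ᵇ k)) ≡ true → b ≡ true
      leftDisjunct {true}  _ = refl
      leftDisjunct {false} e = ⊥-elim (false≢true (trans (sym qR∉old) e))

-- Its points -1,…,-n,1,…,n are coded by
-- their positions 0,…,2n-1 (Defs.pos); letter is the inverse coding.
-- absPos q is |letter q| - 1, so antipodal positions q and q+n have the
-- same absolute value.
module Circle (n' : ℕ) where

  open import Defs
  open Comparisons
  open import Data.Bool using (true; false; if_then_else_)
  open import Data.Nat using (suc; _<_; _≤_; _∸_; _+_; s≤s; z≤n; _<ᵇ_)
  import Data.Nat.Properties as ℕP
  open import Data.Nat.DivMod using (m<n⇒m%n≡m)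
  open import Data.Integer as ℤ using (ℤ; +_; -[1+_])
  open import Data.List using ([]; _∷_; map)
  open import Function using (_∘_)
  open import Data.Product using (_,_)
  open import Data.Sum using (_⊎_; inj₁; inj₂)
  open import Relation.Binary.PropositionalEquality
  -- m = suc (n' + suc (n' + 0)) is 2n by definition.
  open CyclicArithmetic (n' + suc (n' + 0)) public

  n : ℕ
  n = suc n'

  n<m : n < m
  n<m = ℕP.m<m+n n (s≤s z≤n)

  m≡n+n : m ≡ n + n
  m≡n+n = cong (λ z → n + z) (ℕP.+-identityʳ n)

  letter : ℕ → ℤ
  letter q = if q <ᵇ n then -[1+ q ] else + suc (q ∸ n)

  pos-letter : ∀ q → pos n (letter q) ≡ q
  pos-letter q with <ᵇ-dec q n
  ... | inj₁ (_ , e) rewrite e = refl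
  ... | inj₂ (n≤q , e) rewrite e = ℕP.m+[n∸m]≡n n≤q

  pos-map-letter : ∀ ps → map (pos n) (map letter ps) ≡ ps
  pos-map-letter []       = refl
  pos-map-letter (q ∷ ps) = cong₂ _∷_ (pos-letter q) (pos-map-letter ps)

  absPos : ℕ → ℕ
  absPos q = if q <ᵇ n then q else q ∸ n

  abs-letter : ∀ q → ℤ.∣ letter q ∣ ≡ suc (absPos q)
  abs-letter q with q <ᵇ n
  ... | true  = refl
  ... | false = refl

  abs-map-letter : ∀ ps → map ℤ.∣_∣ (map letter ps) ≡ map (suc ∘ absPos) ps
  abs-map-letter []       = refl
  abs-map-letter (q ∷ ps) = cong₂ _∷_ (abs-letter q) (abs-map-letter ps)

  isNeg-letter : ∀ q → isNeg (letter q) ≡ (q <ᵇ n)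
  isNeg-letter q with q <ᵇ n
  ... | true  = refl
  ... | false = refl

  absPos-eq : ∀ x y → x < m → y < m → absPos x ≡ absPos y → y ≡ x ⊎ y ≡ shift x n
  absPos-eq x y x<m y<m e with <ᵇ-dec x n | <ᵇ-dec y n
  ... | inj₁ (_ , ex) | inj₁ (_ , ey) rewrite ex | ey = inj₁ (sym e)
  ... | inj₂ (n≤x , ex) | inj₂ (n≤y , ey) rewrite ex | ey = inj₁ (sym (ℕP.∸-cancelʳ-≡ n≤x n≤y e))
  ... | inj₁ (x<n , ex) | inj₂ (n≤y , ey) rewrite ex | ey =
    inj₂ (sym (trans (m<n⇒m%n≡m x+n<m) (trans (cong (_+ n) e) (ℕP.m∸n+n≡m n≤y))))
    where
    x+n<m : x + n < m
    x+n<m = subst (x + n <_) (sym m≡n+n) (ℕP.+-monoˡ-< n x<n)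
  ... | inj₂ (n≤x , ex) | inj₁ (_ , ey) rewrite ex | ey =
    inj₂ (sym (trans (%-wrap (x + n) (subst (_≤ x + n) (sym m≡n+n) (ℕP.+-monoˡ-≤ n n≤x))
                                     (ℕP.+-mono-< x<m n<m))
                     (trans x+n-m e)))
    where
    x+n-m : x + n ∸ m ≡ x ∸ n
    x+n-m = begin
      x + n ∸ m           ≡⟨ cong (λ z → z + n ∸ m) (ℕP.m∸n+n≡m {x} {n} n≤x) ⟨
      x ∸ n + n + n ∸ m   ≡⟨ cong (_∸ m) (ℕP.+-assoc (x ∸ n) n n) ⟩
      x ∸ n + (n + n) ∸ m ≡⟨ cong (λ z → x ∸ n + z ∸ m) m≡n+n ⟨
      x ∸ n + m ∸ m       ≡⟨ ℕP.m+n∸n≡m (x ∸ n) m ⟩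
      x ∸ n               ∎
      where open ≡-Reasoning

module BooleanListFacts where

  open import Defs using (memℕ; _≡Bool_)
  open Comparisons
  open import Data.Bool using (Bool; true; false; _∨_)
  open import Data.Nat using (ℕ; zero; suc; _<_; _≡ᵇ_; s≤s; z≤n)
  open import Data.List using (List; []; _∷_; map; upTo; applyUpTo)
  open import Data.Bool.ListAction using (and; or; any; all)
  import Data.List.Properties as LP
  open import Data.Product using (Σ; _×_; _,_)
  open import Relation.Binary.PropositionalEquality
  open import Function using (_∘_)

  memℕ-map⇒ : ∀ (f : ℕ → ℕ) x ps → memℕ x (map f ps) ≡ true → Σ ℕ λ y → memℕ y ps ≡ true × f y ≡ x
  memℕ-map⇒ f x (y ∷ ps) e with x ≡ᵇ f y in x≡fy
  ... | true = y , ∨-trueˡ (memℕ y ps) (≡ᵇ-t {y} refl) , sym (≡ᵇ-≡ x≡fy)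
  ... | false with memℕ-map⇒ f x ps e
  ... | z , z∈ps , fz≡x = z , ∨-trueʳ (z ≡ᵇ y) z∈ps , fz≡x

  memℕ-map⇐ : ∀ (f : ℕ → ℕ) y ps → memℕ y ps ≡ true → memℕ (f y) (map f ps) ≡ true
  memℕ-map⇐ f y (z ∷ ps) e with y ≡ᵇ z in y≡z
  ... | true  = ∨-trueˡ (memℕ (f y) (map f ps)) (≡ᵇ-t (cong f (≡ᵇ-≡ y≡z)))
  ... | false = ∨-trueʳ (f y ≡ᵇ f z) (memℕ-map⇐ f y ps e)

  memℕ-suc : ∀ x ps → memℕ (suc x) (map suc ps) ≡ memℕ x ps
  memℕ-suc x []       = refl
  memℕ-suc x (y ∷ ps) = cong ((x ≡ᵇ y) ∨_) (memℕ-suc x ps)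

  ≡Bool-refl : ∀ b → (b ≡Bool b) ≡ true
  ≡Bool-refl true  = refl
  ≡Bool-refl false = refl

  ≡Bool⇒≡ : ∀ a b → (a ≡Bool b) ≡ true → a ≡ b
  ≡Bool⇒≡ true  true  _ = refl
  ≡Bool⇒≡ false false _ = refl

  any⇒ : ∀ (f : ℕ → Bool) M → any f (upTo M) ≡ true → Σ ℕ λ s → s < M × f s ≡ true
  any⇒ f M e = go f M (trans (cong or (sym (LP.map-upTo f M))) e)
    where
    go : ∀ (f : ℕ → Bool) M → or (applyUpTo f M) ≡ true → Σ ℕ λ s → s < M × f s ≡ true
    go f (suc M) e with f 0 in f0
    ... | true  = 0 , s≤s z≤n , f0
    ... | false with go (f ∘ suc) M e
    ... | s , s<M , fs = suc s , s≤s s<M , fs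

  any⇐ : ∀ (f : ℕ → Bool) M s → s < M → f s ≡ true → any f (upTo M) ≡ true
  any⇐ f M s s<M fs = trans (cong or (LP.map-upTo f M)) (go f M s s<M fs)
    where
    go : ∀ (f : ℕ → Bool) M s → s < M → f s ≡ true → or (applyUpTo f M) ≡ true
    go f (suc M) zero    _         fs rewrite fs = refl
    go f (suc M) (suc s) (s≤s s<M) fs = ∨-trueʳ (f 0) (go (f ∘ suc) M s s<M fs)

  all⇒ : ∀ (f : ℕ → Bool) M → all f (upTo M) ≡ true → ∀ s → s < M → f s ≡ true
  all⇒ f M e = go f M (trans (cong and (sym (LP.map-upTo f M))) e)
    where
    go : ∀ (f : ℕ → Bool) M → and (applyUpTo f M) ≡ true → ∀ s → s < M → f s ≡ true
    go f (suc M) e s s<M with f 0 in f0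
    go f (suc M) e zero    _         | true  = f0
    go f (suc M) e (suc s) (s≤s s<M) | true  = go (f ∘ suc) M e s s<M
    go f (suc M) () s s<M            | false

  all⇐ : ∀ (f : ℕ → Bool) M → (∀ s → s < M → f s ≡ true) → all f (upTo M) ≡ true
  all⇐ f M h = trans (cong and (LP.map-upTo f M)) (go f M h)
    where
    go : ∀ (f : ℕ → Bool) M → (∀ s → s < M → f s ≡ true) → and (applyUpTo f M) ≡ true
    go f zero    h = refl
    go f (suc M) h rewrite h 0 (s≤s z≤n) = go (f ∘ suc) M (λ s s<M → h (suc s) (s≤s s<M))

-- Write a word as
-- the list ps of positions of its letters.
module ArcExtension (n' : ℕ) where

  open import Defs
  open Comparisons
  open BooleanListFacts
  open Circle n'
  open import Data.Bool using (Bool; true; false; _∧_; _∨_; not)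
  open import Data.Nat as ℕ using (ℕ; suc; _<_; _≤_; _≥_; _∸_; _+_; _<ᵇ_; _≡ᵇ_)
  import Data.Nat.Properties as ℕP
  open import Data.Integer as ℤ using ()
  open import Data.List using (List; _∷_; map; length; upTo)
  open import Data.Bool.ListAction using (any; all)
  import Data.List.Properties as LP
  open import Data.Product using (_,_; proj₁; proj₂)
  open import Data.Sum using (inj₁; inj₂)
  open import Data.Empty using (⊥; ⊥-elim)
  open import Relation.Binary.PropositionalEquality
  open import Relation.Nullary using (¬_; yes; no)
  open import Data.Nat.Tactic.RingSolver using (solve-∀)

  isInterval-letters : ∀ ps → isInterval n (map letter ps) ≡
    any (λ s → all (λ p → memℕ p ps ≡Bool (cdist m s p <ᵇ length ps)) (upTo m)) (upTo m)
  isInterval-letters ps rewrite pos-map-letter ps | LP.length-map letter ps = refl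

  record Arc (ps : List ℕ) (t k : ℕ) : Set where
    field
      t<m : t < m
      len : length ps ≡ k
      bnd : ∀ x → memℕ x ps ≡ true → x < m
      mem : ∀ x → x < m → memℕ x ps ≡ (cdist m t x <ᵇ k)
  open Arc public

  admissible : ℕ → List ℕ → Bool
  admissible q ps = not (memℕ ℤ.∣ letter q ∣ (map ℤ.∣_∣ (map letter ps)))
                    ∧ isInterval n (letter q ∷ map letter ps)

  absPos-mem : ∀ q ps → memℕ ℤ.∣ letter q ∣ (map ℤ.∣_∣ (map letter ps)) ≡ memℕ (absPos q) (map absPos ps)
  absPos-mem q ps rewrite abs-letter q | abs-map-letter ps | LP.map-∘ {g = suc} {f = absPos} ps =
    memℕ-suc (absPos q) (map absPos ps)

  interval-from-arc : ∀ q ps s → s < m →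
    (∀ p → p < m → memℕ p (q ∷ ps) ≡ (cdist m s p <ᵇ suc (length ps))) →
    isInterval n (letter q ∷ map letter ps) ≡ true
  interval-from-arc q ps s s<m h = trans (isInterval-letters (q ∷ ps))
    (any⇐ _ m s s<m (all⇐ _ m (λ p p<m →
      trans (cong (_≡Bool (cdist m s p <ᵇ suc (length ps))) (h p p<m)) (≡Bool-refl (cdist m s p <ᵇ suc (length ps))))))

  absPos-fresh : ∀ {ps t k} → Arc ps t k → ∀ q → q < m → cdist m t q ≥ k → cdist m t (shift q n) ≥ k →
    memℕ (absPos q) (map absPos ps) ≡ false
  absPos-fresh {ps} {t} {k} A q q<m q∉ q'∉ with memℕ (absPos q) (map absPos ps) in eq
  ... | false = refl
  ... | true with memℕ-map⇒ absPos (absPos q) ps eq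
  ... | y , y∈ , absy with absPos-eq q y q<m (bnd A y y∈) (sym absy)
  ... | inj₁ refl = ⊥-elim (false≢true (trans (sym (<ᵇ-f q∉)) (trans (sym (mem A q q<m)) y∈)))
  ... | inj₂ refl = ⊥-elim (false≢true (trans (sym (<ᵇ-f q'∉)) (trans (sym (mem A (shift q n) (shift<m q n))) y∈)))

  k<m : ∀ {k} → k < n → k < m
  k<m k<n = ℕP.<-trans k<n n<m

  antipode-back : ∀ t → shift (shift t (m ∸ 1)) n ≡ shift t n'
  antipode-back t = trans (shift-assoc t (m ∸ 1) n) (trans (cong (shift t) (arith n')) (shift-m t n'))
    where
    arith : ∀ a → (a + suc (a + 0)) + suc a ≡ a + suc (a + suc (a + 0))
    arith = solve-∀

  admissible-left : ∀ {ps t k} → Arc ps t k → k < n → admissible (shift t (m ∸ 1)) ps ≡ true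
  admissible-left {ps} {t} {k} A k<n = cong₂ _∧_ (cong not (trans (absPos-mem qL ps) fresh)) interval
    where
    qL = shift t (m ∸ 1)
    fresh : memℕ (absPos qL) (map absPos ps) ≡ false
    fresh = absPos-fresh A qL (shift<m t (m ∸ 1))
      (subst (k ≤_) (sym (cdist-back t (t<m A))) (ℕP.<⇒≤pred (k<m k<n)))
      (subst (k ≤_) (sym (trans (cong (cdist m t) (antipode-back t)) (cdist-shift t n' (t<m A) (ℕP.<-trans (ℕP.n<1+n n') n<m))))
             (ℕP.≤-pred k<n))
    interval : isInterval n (letter qL ∷ map letter ps) ≡ true
    interval = interval-from-arc qL ps qL (shift<m t (m ∸ 1)) (λ p p<m →
      trans (cong ((p ≡ᵇ qL) ∨_) (mem A p p<m))
            (trans (arc-extendˡ t k p (t<m A) p<m) (cong (λ z → cdist m qL p <ᵇ suc z) (sym (len A)))))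

  admissible-right : ∀ {ps t k} → Arc ps t k → k < n → admissible (shift t k) ps ≡ true
  admissible-right {ps} {t} {k} A k<n = cong₂ _∧_ (cong not (trans (absPos-mem qR ps) fresh)) interval
    where
    qR = shift t k
    k+n<m : k + n < m
    k+n<m = subst (k + n <_) (sym m≡n+n) (ℕP.+-monoˡ-< n k<n)
    fresh : memℕ (absPos qR) (map absPos ps) ≡ false
    fresh = absPos-fresh A qR (shift<m t k)
      (subst (k ≤_) (sym (cdist-shift t k (t<m A) (k<m k<n))) ℕP.≤-refl)
      (subst (k ≤_) (sym (trans (cong (cdist m t) (shift-assoc t k n)) (cdist-shift t (k + n) (t<m A) k+n<m)))
             (ℕP.m≤m+n k n))
    interval : isInterval n (letter qR ∷ map letter ps) ≡ true
    interval = interval-from-arc qR ps t (t<m A) (λ p p<m →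
      trans (cong ((p ≡ᵇ qR) ∨_) (mem A p p<m))
            (trans (arc-extendʳ t k p (t<m A) (k<m k<n) p<m) (cong (λ z → cdist m t p <ᵇ suc z) (sym (len A)))))

  admissible-other : ∀ {ps t k} → Arc ps t k → 1 ≤ k → k < n → ∀ q → q < m →
    ¬ (q ≡ shift t (m ∸ 1)) → ¬ (q ≡ shift t k) → admissible q ps ≡ false
  admissible-other {ps} {t} {k} A 1≤k k<n q q<m q≢qL q≢qR
    with memℕ (absPos q) (map absPos ps) in q∈?
  ... | true = cong (λ z → not z ∧ isInterval n (letter q ∷ map letter ps)) (trans (absPos-mem q ps) q∈?)
  ... | false with isInterval n (letter q ∷ map letter ps) in isInt
  ... | false = cong₂ (λ a b → not a ∧ b) (trans (absPos-mem q ps) q∈?) refl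
  ... | true = ⊥-elim contradiction
    where
    witness = any⇒ _ m (trans (sym (isInterval-letters (q ∷ ps))) isInt)
    s = proj₁ witness
    s<m = proj₁ (proj₂ witness)
    q∉ : k ≤ cdist m t q
    q∉ with <ᵇ-dec (cdist m t q) k
    ... | inj₂ (le , _) = le
    ... | inj₁ (_ , e) = ⊥-elim (false≢true (trans (sym q∈?) (memℕ-map⇐ absPos q ps (trans (mem A q q<m) e))))
    sameArc : ∀ p → p < m → ((p ≡ᵇ q) ∨ (cdist m t p <ᵇ k)) ≡ (cdist m s p <ᵇ suc k)
    sameArc p p<m = trans (cong ((p ≡ᵇ q) ∨_) (sym (mem A p p<m)))
      (trans (≡Bool⇒≡ _ _ (all⇒ _ m (proj₂ (proj₂ witness)) p p<m))
             (cong (λ z → cdist m s p <ᵇ suc z) (len A)))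
    contradiction : ⊥
    contradiction with arc-extension-unique t s k q (t<m A) s<m q<m 1≤k (ℕP.≤-<-trans k<n n<m) q∉ sameArc
    ... | inj₁ e = q≢qL e
    ... | inj₂ e = q≢qR e

  admissible-iff : ∀ {ps t k} → Arc ps t k → 1 ≤ k → k < n → ∀ q → q < m →
    admissible q ps ≡ ((q ≡ᵇ shift t (m ∸ 1)) ∨ (q ≡ᵇ shift t k))
  admissible-iff {ps} {t} {k} A 1≤k k<n q q<m with q ℕ.≟ shift t (m ∸ 1) | q ℕ.≟ shift t k
  ... | yes refl | _ = trans (admissible-left A k<n) (sym (∨-trueˡ (q ≡ᵇ shift t k) (≡ᵇ-t {q} refl)))
  ... | no _ | yes refl = trans (admissible-right A k<n) (sym (∨-trueʳ (q ≡ᵇ shift t (m ∸ 1)) (≡ᵇ-t {q} refl)))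
  ... | no q≢qL | no q≢qR =
    trans (admissible-other A 1≤k k<n q q<m q≢qL q≢qR) (sym (∨-false (≡ᵇ-f q≢qL) (≡ᵇ-f q≢qR)))

-- B-arc permutations are built from their last letter, at position p,
-- by prepending one letter at a time; each step extends the current arc
-- (t,k) either to the left (the new letter is t-1) or to the right (it is
-- t+k).  A bit sequence e records these choices, the most recent one
-- first (true = right).
module ArcEnumeration (n' : ℕ) where

  open import Defs
  open Comparisons
  open PolynomialArithmetic
  open FiniteSums
  open Circle n'
  open ArcExtension n'
  open import Data.Bool using (Bool; true; false; _∧_; _∨_; not)
  import Data.Bool.Properties as BoolP
  open import Data.Nat as ℕ using (ℕ; zero; suc; _<_; _≤_; _∸_; _+_; s≤s; z≤n; _<ᵇ_; _≡ᵇ_)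
  import Data.Nat.Properties as ℕP
  open import Data.Integer as ℤ using (ℤ; +_; -[1+_])
  open import Data.List using (List; []; _∷_; map; length; upTo; concatMap)
  open import Relation.Binary.PropositionalEquality
  open import Relation.Nullary using (¬_; yes; no)
  open import Data.Empty using (⊥-elim)
  open import Algebra.Bundles using (CommutativeMonoid)
  open import Algebra.Properties.CommutativeSemigroup
    (CommutativeMonoid.commutativeSemigroup BoolP.∧-commutativeMonoid)
    using () renaming (interchange to ∧-interchange)

  arcStart : ℕ → List Bool → ℕ
  arcStart p []          = p
  arcStart p (true ∷ e)  = arcStart p e
  arcStart p (false ∷ e) = shift (arcStart p e) (m ∸ 1)

  newLetter : ℕ → Bool → List Bool → ℕ
  newLetter p true  e = shift (arcStart p e) (suc (length e))
  newLetter p false e = shift (arcStart p e) (m ∸ 1)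

  arcWord : ℕ → List Bool → List ℕ
  arcWord p []      = p ∷ []
  arcWord p (b ∷ e) = newLetter p b e ∷ arcWord p e

  arcPerm : ℕ → List Bool → List ℤ
  arcPerm p e = map letter (arcWord p e)

  arcStart<m : ∀ p e → p < m → arcStart p e < m
  arcStart<m p []          p<m = p<m
  arcStart<m p (true ∷ e)  p<m = arcStart<m p e p<m
  arcStart<m p (false ∷ e) p<m = shift<m (arcStart p e) (m ∸ 1)

  arc-singleton : ∀ q p → q < m → p < m → ((p ≡ᵇ q) ∨ false) ≡ (cdist m q p <ᵇ 1)
  arc-singleton q p q<m p<m with p ℕ.≟ q
  ... | yes refl rewrite ≡ᵇ-t {p} refl | cdist-self p = refl
  ... | no p≢q rewrite ≡ᵇ-f p≢q with cdist m q p in d≡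
  ... | zero  = ⊥-elim (p≢q (trans (sym (shift-cdist q p q<m p<m)) (trans (cong (shift q) d≡) (shift-zero q q<m))))
  ... | suc _ = refl

  arcWord-isArc : ∀ p e → p < m → suc (length e) ≤ n → Arc (arcWord p e) (arcStart p e) (suc (length e))
  arcWord-isArc p [] p<m _ = record
    { t<m = p<m ; len = refl
    ; bnd = λ x x∈ → subst (_< m) (sym (≡ᵇ-≡ (trans (sym (BoolP.∨-identityʳ _)) x∈))) p<m
    ; mem = λ x x<m → arc-singleton p x p<m x<m }
  arcWord-isArc p (b ∷ e) p<m k<n = step b
    where
    A = arcWord-isArc p e p<m (ℕP.<⇒≤ k<n)
    k = suc (length e)
    t = arcStart p e
    bnd' : ∀ q → q < m → ∀ x → memℕ x (q ∷ arcWord p e) ≡ true → x < m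
    bnd' q q<m x x∈ with x ≡ᵇ q in x≡q
    ... | true  = subst (_< m) (sym (≡ᵇ-≡ x≡q)) q<m
    ... | false = bnd A x x∈
    step : ∀ b → Arc (arcWord p (b ∷ e)) (arcStart p (b ∷ e)) (suc k)
    step true = record
      { t<m = t<m A ; len = cong suc (len A) ; bnd = bnd' _ (shift<m t k)
      ; mem = λ x x<m → trans (cong ((x ≡ᵇ shift t k) ∨_) (mem A x x<m))
                              (arc-extendʳ t k x (t<m A) (k<m k<n) x<m) }
    step false = record
      { t<m = shift<m t (m ∸ 1) ; len = cong suc (len A) ; bnd = bnd' _ (shift<m t (m ∸ 1))
      ; mem = λ x x<m → trans (cong ((x ≡ᵇ shift t (m ∸ 1)) ∨_) (mem A x x<m))
                              (arc-extendˡ t k x (t<m A) x<m) }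

  Σ-alphabet : ∀ (f : ℤ → Poly) → ΣL (alphabet n) f ≋ Σ< m (λ q → f (letter q))
  Σ-alphabet f = begin
      ΣL (alphabet n) f
        ≈⟨ ΣL-++ (map (λ i → -[1+ i ]) (upTo n)) (map (λ i → + suc i) (upTo n)) f ⟩
      ΣL (map (λ i → -[1+ i ]) (upTo n)) f ⊕ ΣL (map (λ i → + suc i) (upTo n)) f
        ≈⟨ ⊕-cong (≡⇒≋ (trans (ΣL-map (λ i → -[1+ i ]) (upTo n) f) (ΣL-upTo n (λ i → f -[1+ i ]))))
                  (≡⇒≋ (trans (ΣL-map (λ i → + suc i) (upTo n) f) (ΣL-upTo n (λ i → f (+ suc i))))) ⟩
      Σ< n (λ i → f -[1+ i ]) ⊕ Σ< n (λ i → f (+ suc i))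
        ≈⟨ ⊕-cong (Σ<-cong n (λ i i<n → ≡⇒≋ (cong f (negative i i<n))))
                  (Σ<-cong n (λ i _ → ≡⇒≋ (cong f (positive i)))) ⟨
      Σ< n (λ q → f (letter q)) ⊕ Σ< n (λ i → f (letter (n + i)))
        ≈⟨ Σ<-split n n (λ q → f (letter q)) ⟨
      Σ< (n + n) (λ q → f (letter q))
        ≈⟨ ≡⇒≋ (cong (λ z → Σ< z (λ q → f (letter q))) m≡n+n) ⟨
      Σ< m (λ q → f (letter q)) ∎
    where
    open ≋-Reasoning
    negative : ∀ i → i < n → letter i ≡ -[1+ i ]
    negative i i<n rewrite <ᵇ-t i<n = refl
    positive : ∀ i → letter (n + i) ≡ + suc i
    positive i rewrite <ᵇ-f (ℕP.m≤m+n n i) | ℕP.m+n∸m≡n n i = refl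

  isBArcWord : List ℤ → Bool
  isBArcWord w = isSignedPerm w ∧ isBArc n w

  prependable : ℤ → List ℤ → Bool
  prependable a v = not (memℕ ℤ.∣ a ∣ (map ℤ.∣_∣ v)) ∧ isInterval n (a ∷ v)

  isBArcWord-cons : ∀ a v (P : Poly) →
    onlyIf (isBArcWord (a ∷ v)) P ≡ onlyIf (isBArcWord v) (onlyIf (prependable a v) P)
  isBArcWord-cons a v P = begin
      onlyIf ((x ∧ y) ∧ (z ∧ w)) P ≡⟨ cong (λ b → onlyIf b P) (∧-interchange x y z w) ⟩
      onlyIf ((x ∧ z) ∧ (y ∧ w)) P ≡⟨ cong (λ b → onlyIf b P) (BoolP.∧-comm (x ∧ z) (y ∧ w)) ⟩
      onlyIf ((y ∧ w) ∧ (x ∧ z)) P ≡⟨ onlyIf-∧ (y ∧ w) (x ∧ z) P ⟨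
      onlyIf (y ∧ w) (onlyIf (x ∧ z) P) ∎
    where
    open ≡-Reasoning
    x = not (memℕ ℤ.∣ a ∣ (map ℤ.∣_∣ v))
    y = distinctℕ (map ℤ.∣_∣ v)
    z = isInterval n (a ∷ v)
    w = isBArc n v

  Σ-prepend : ∀ (g : List ℤ → Poly) p e → p < m → suc (length e) < n →
    ΣL (alphabet n) (λ a → onlyIf (prependable a (arcPerm p e)) (g (a ∷ arcPerm p e)))
      ≋ g (arcPerm p (false ∷ e)) ⊕ g (arcPerm p (true ∷ e))
  Σ-prepend g p e p<m k<n = begin
      ΣL (alphabet n) (λ a → onlyIf (prependable a (arcPerm p e)) (g (a ∷ arcPerm p e)))
        ≈⟨ Σ-alphabet (λ a → onlyIf (prependable a (arcPerm p e)) (g (a ∷ arcPerm p e))) ⟩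
      Σ< m (λ q → onlyIf (admissible q (arcWord p e)) (G q))
        ≈⟨ Σ<-cong m (λ q q<m → ≡⇒≋ (cong (λ b → onlyIf b (G q)) (admissible-iff A (s≤s z≤n) k<n q q<m))) ⟩
      Σ< m (λ q → onlyIf ((q ≡ᵇ qL) ∨ (q ≡ᵇ qR)) (G q))
        ≈⟨ Σ<-two-points m qL qR G (shift<m t (m ∸ 1)) (shift<m t k) qL≢qR ⟩
      G qL ⊕ G qR ∎
    where
    open ≋-Reasoning
    k  = suc (length e)
    t  = arcStart p e
    qL = shift t (m ∸ 1)
    qR = shift t k
    G : ℕ → Poly
    G q = g (letter q ∷ arcPerm p e)
    A = arcWord-isArc p e p<m (ℕP.<⇒≤ k<n)
    qL≢qR : ¬ (qL ≡ qR)
    qL≢qR eq = ℕP.<⇒≢ (ℕP.<-≤-trans k<n (ℕP.<⇒≤pred n<m))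
      (trans (sym (cdist-shift t k (t<m A) (k<m k<n))) (trans (cong (cdist m t) (sym eq)) (cdist-back t (t<m A))))

  enumerate-BArc : ∀ j (g : List ℤ → Poly) → suc j ≤ n →
    ΣL (words (suc j) (alphabet n)) (λ w → onlyIf (isBArcWord w) (g w))
      ≋ Σ< m (λ p → ΣBits j (λ e → g (arcPerm p e)))
  enumerate-BArc zero g _ =
    ≈trans (ΣL-concatMap (λ a → map (a ∷_) ([] ∷ [])) (alphabet n) F)
      (≈trans (Σ-alphabet (λ a → ΣL (map (a ∷_) ([] ∷ [])) F))
              (Σ<-cong m (λ q q<m → ≈trans (⊕-idʳ (F (letter q ∷ [])))
                                           (≡⇒≋ (cong (λ b → onlyIf b (g (letter q ∷ []))) (single q q<m))))))
    where
    F : List ℤ → Poly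
    F w = onlyIf (isBArcWord w) (g w)
    single : ∀ q → q < m → isBArcWord (letter q ∷ []) ≡ true
    single q q<m = cong (_∧ true) (interval-from-arc q [] q q<m (λ p p<m → arc-singleton q p q<m p<m))
  enumerate-BArc (suc j) g j+2≤n = begin
      ΣL (concatMap (λ a → map (a ∷_) Ws) As) F
        ≈⟨ ΣL-concatMap (λ a → map (a ∷_) Ws) As F ⟩
      ΣL As (λ a → ΣL (map (a ∷_) Ws) F)
        ≈⟨ ΣL-cong As (λ a → ≈trans (≡⇒≋ (ΣL-map (a ∷_) Ws F))
                                    (ΣL-cong Ws (λ v → ≡⇒≋ (isBArcWord-cons a v (g (a ∷ v)))))) ⟩
      ΣL As (λ a → ΣL Ws (λ v → onlyIf (isBArcWord v) (H a v)))
        ≈⟨ ΣL-swap As Ws (λ a v → onlyIf (isBArcWord v) (H a v)) ⟩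
      ΣL Ws (λ v → ΣL As (λ a → onlyIf (isBArcWord v) (H a v)))
        ≈⟨ ΣL-cong Ws (λ v → ΣL-onlyIf As (isBArcWord v) (λ a → H a v)) ⟩
      ΣL Ws (λ v → onlyIf (isBArcWord v) (g' v))
        ≈⟨ enumerate-BArc j g' (ℕP.<⇒≤ j+2≤n) ⟩
      Σ< m (λ p → ΣBits j (λ e → g' (arcPerm p e)))
        ≈⟨ Σ<-cong m (λ p p<m → ΣBits-cong j (λ e len≡ → Σ-prepend g p e p<m (subst (λ l → suc l < n) (sym len≡) j+2≤n))) ⟩
      Σ< m (λ p → ΣBits (suc j) (λ e → g (arcPerm p e))) ∎
    where
    open ≋-Reasoning
    As = alphabet n
    Ws = words (suc j) As
    F : List ℤ → Poly
    F w = onlyIf (isBArcWord w) (g w)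
    H : ℤ → List ℤ → Poly
    H a v = onlyIf (prependable a v) (g (a ∷ v))
    g' : List ℤ → Poly
    g' v = ΣL As (λ a → H a v)

module LetterStatistics (n' : ℕ) where

  open import Defs
  open Circle n'
  open import Data.Bool using (true; false; if_then_else_)
  open import Data.Nat using (ℕ; suc; _+_; _*_; _<ᵇ_; _<?_)
  open import Data.Integer as ℤ using ()
  open import Data.List using (List; []; _∷_; map; length; filter)
  open import Relation.Binary.PropositionalEquality
  open import Function using (_∘_)

  majP : ℕ → List ℕ → ℕ
  majP i []          = 0
  majP i (x ∷ [])    = 0
  majP i (x ∷ y ∷ w) = (if y <ᵇ x then i else 0) + majP (suc i) (y ∷ w)

  negP : List ℕ → ℕ
  negP []      = 0
  negP (x ∷ w) = (if x <ᵇ n then 1 else 0) + negP w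

  majFrom-letters : ∀ i ps → majFrom n i (map letter ps) ≡ majP i ps
  majFrom-letters i []          = refl
  majFrom-letters i (x ∷ [])    = refl
  majFrom-letters i (x ∷ y ∷ w) =
    cong₂ _+_ (cong₂ (λ a b → if b <ᵇ a then i else 0) (pos-letter x) (pos-letter y))
              (majFrom-letters (suc i) (y ∷ w))

  neg-letters : ∀ ps → neg (map letter ps) ≡ negP ps
  neg-letters []       = refl
  neg-letters (x ∷ ps) rewrite isNeg-letter x = cong ((if x <ᵇ n then 1 else 0) +_) (neg-letters ps)

  fmaj-letters : ∀ ps → fmaj n (map letter ps) ≡ 2 * majP 1 ps + negP ps
  fmaj-letters ps = cong₂ (λ a b → 2 * a + b) (majFrom-letters 1 ps) (neg-letters ps)

  countAbs : ℕ → List ℕ → ℕ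
  countAbs x []       = 0
  countAbs x (y ∷ ys) = (if absPos y <ᵇ x then 1 else 0) + countAbs x ys

  invAbs : List ℕ → ℕ
  invAbs []      = 0
  invAbs (x ∷ w) = countAbs (absPos x) w + invAbs w

  countAbs-filter : ∀ x ys →
    length (filter (λ y → y <? suc x) (map (suc ∘ absPos) ys)) ≡ countAbs x ys
  countAbs-filter x []       = refl
  countAbs-filter x (y ∷ ys) with absPos y <ᵇ x
  ... | true  = cong suc (countAbs-filter x ys)
  ... | false = countAbs-filter x ys

  inv-letters : ∀ ps → inv (map ℤ.∣_∣ (map letter ps)) ≡ invAbs ps
  inv-letters ps rewrite abs-map-letter ps = go ps
    where
    go : ∀ ps → inv (map (suc ∘ absPos) ps) ≡ invAbs ps
    go []       = refl
    go (x ∷ ps) = cong₂ _+_ (countAbs-filter (absPos x) ps) (go ps)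

-- Building an arc word letter by letter, fmaj
-- changes at each step by an amount depending on the current arc (t,k),
-- the new letter q and the current first letter f.  We find a potential
-- function of the arc such that
--   (change of fmaj) + (change of potential) = 0               for a left step,
--   (change of fmaj) + (change of potential) = 2(n-k) - 1      for a right step;
-- the potential vanishes on the full arc, which yields the fmaj formula
-- of the next module.  The potential depends on whether the last step was
-- a right step (flag fl), because that determines the first letter f.
module FmajPotential (n' : ℕ) where

  open Comparisons
  open Circle n'
  open import Data.Bool using (Bool; true; false; if_then_else_)
  open import Data.Nat using (ℕ; zero; suc; _<_; _≤_; _∸_; _+_; _*_; s≤s; z≤n; _<ᵇ_; _≤ᵇ_; _%_)
  import Data.Nat.Properties as ℕP
  open import Data.Nat.DivMod using (m<n⇒m%n≡m; [m+n]%n≡m%n; n%n≡0)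
  open import Data.Sum using (inj₁; inj₂)
  open import Data.Product using (_,_)
  open import Relation.Binary.PropositionalEquality
  open import Relation.Binary.Definitions using (tri<; tri≈; tri>)
  open import Data.Nat.Tactic.RingSolver using (solve-∀)

  -- The potential of the arc (t,k).  It is kept opaque and used only via
  -- the four equations below, one for each region of t.
  opaque
    potential : ℕ → ℕ → Bool → ℕ
    potential k t fl =
      if m <ᵇ t + k then (if fl then 2 * (n ∸ k) else 0)
      else if t ≤ᵇ n ∸ k then 2 * (n ∸ k) ∸ t
      else if t ≤ᵇ n then n ∸ k
      else n + (n ∸ k) ∸ t

  opaque
    unfolding potential

    potential-wrap : ∀ {k t} fl → m < t + k → potential k t fl ≡ (if fl then 2 * (n ∸ k) else 0)
    potential-wrap fl wraps rewrite <ᵇ-t wraps = refl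

    potential-lo : ∀ {k t} fl → t + k ≤ m → t ≤ n ∸ k → potential k t fl ≡ 2 * (n ∸ k) ∸ t
    potential-lo fl inside t≤ rewrite <ᵇ-f inside | ≤ᵇ-t t≤ = refl

    potential-mid : ∀ {k t} fl → t + k ≤ m → n ∸ k < t → t ≤ n → potential k t fl ≡ n ∸ k
    potential-mid fl inside <t t≤n rewrite <ᵇ-f inside | ≤ᵇ-f <t | ≤ᵇ-t t≤n = refl

    potential-hi : ∀ {k t} fl → t + k ≤ m → n < t → potential k t fl ≡ n + (n ∸ k) ∸ t
    potential-hi {k} {t} fl inside n<t
      rewrite <ᵇ-f inside | ≤ᵇ-f (ℕP.≤-<-trans (ℕP.m∸n≤m n k) n<t) | ≤ᵇ-f n<t = refl

  -- The first letter f of the arc word: t after a left step, t+k-1 after a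
  -- right step.
  FirstLetter : Bool → ℕ → ℕ → ℕ → Set
  FirstLetter false f t k = f ≡ t
  FirstLetter true  f t k = f ≡ shift t (k ∸ 1)

  -- The increase of fmaj when q is prepended to a word starting with f,
  -- the new letter sitting at index r = n - k: a descent at r counts 2r,
  -- a negative letter counts 1.
  prependFmaj : ℕ → ℕ → ℕ → ℕ
  prependFmaj f q r = 2 * (if f <ᵇ q then r else 0) + (if q <ᵇ n then 1 else 0)

  StepˡGoal : ℕ → ℕ → Bool → ℕ → Set
  StepˡGoal t k fl f =
    prependFmaj f (shift t (m ∸ 1)) (n ∸ k) + potential (suc k) (shift t (m ∸ 1)) false ≡ potential k t fl

  StepʳGoal : ℕ → ℕ → Bool → ℕ → ℕ → Set
  StepʳGoal t k fl f q =
    prependFmaj f q (n ∸ k) + potential (suc k) t true ≡ potential k t fl + (2 * (n ∸ k) ∸ 1)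

  n∸k≡suc : ∀ {k} → k < n → n ∸ k ≡ suc (n ∸ suc k)
  n∸k≡suc k<n = ℕP.+-∸-assoc 1 k<n

  shift-lo : ∀ {t d} → t + d < m → shift t d ≡ t + d
  shift-lo lt = m<n⇒m%n≡m lt

  shift-hi : ∀ {t d} → m ≤ t + d → t < m → d < m → shift t d ≡ t + d ∸ m
  shift-hi {t} {d} le t<m d<m = %-wrap (t + d) le (ℕP.+-mono-< t<m d<m)

  2*-if : ∀ fl r → 2 * (if fl then r else 0) ≡ (if fl then 2 * r else 0)
  2*-if true  r = refl
  2*-if false r = refl

  n≤m-1 : n ≤ m ∸ 1
  n≤m-1 = ℕP.<⇒≤pred n<m

  arith-A : ∀ r0 X → 2 * suc r0 + 1 + X ≡ (2 + X) + (r0 + suc (r0 + 0))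
  arith-A = solve-∀
  arith-B : ∀ r0 → 2 * suc r0 + 0 + r0 ≡ suc r0 + (r0 + suc (r0 + 0))
  arith-B = solve-∀
  arith-C : ∀ r0 Y → 2 * suc r0 + 0 + Y ≡ suc Y + (r0 + suc (r0 + 0))
  arith-C = solve-∀
  arith-D : ∀ r0 → 1 + 2 * r0 ≡ r0 + suc (r0 + 0)
  arith-D = solve-∀
  arith-E : ∀ r0 → 2 * suc r0 + 1 + 2 * r0 ≡ 2 * suc r0 + (r0 + suc (r0 + 0))
  arith-E = solve-∀
  arith-F : ∀ r0 → 2 * suc r0 ≡ 2 + 2 * r0
  arith-F = solve-∀

  -- From the arc starting at 0 the new letter is m-1, which is positive and
  -- exceeds the first letter; the new arc wraps.
  potential-stepˡ-0 : ∀ k fl f → 1 ≤ k → k < n → FirstLetter fl f 0 k → StepˡGoal 0 k fl f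
  potential-stepˡ-0 k@(suc k') fl f 1≤k k<n fr = goal
    where
    k<m : k < m
    k<m = ℕP.<-trans k<n n<m
    wraps : m < m ∸ 1 + suc k
    wraps = subst (m <_) (sym (trans (ℕP.+-suc (m ∸ 1) k) (cong suc (ℕP.+-suc (m ∸ 1) k'))))
                  (s≤s (s≤s (ℕP.m≤m+n (m ∸ 1) k')))
    f<m-1 : ∀ fl {f} → FirstLetter fl f 0 k → f < m ∸ 1
    f<m-1 false refl = ℕP.<-≤-trans (s≤s z≤n) n≤m-1
    f<m-1 true  refl = subst (_< m ∸ 1) (sym (shift-lo {0} {k'} (ℕP.<-trans (ℕP.n<1+n k') k<m)))
                             (ℕP.∸-monoˡ-< k<m 1≤k)
    goal : StepˡGoal 0 k fl f
    goal rewrite shift-lo {0} {m ∸ 1} m-1<m | <ᵇ-t (f<m-1 fl fr) | <ᵇ-f n≤m-1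
               | potential-wrap {suc k} {m ∸ 1} false wraps
               | potential-lo {k} {0} fl (ℕP.<⇒≤ k<m) z≤n = trans (ℕP.+-identityʳ _) (ℕP.+-identityʳ _)

  shift-suc-back : ∀ t0 → suc t0 < m → shift (suc t0) (m ∸ 1) ≡ t0
  shift-suc-back t0 lt =
    trans (cong (_% m) (sym (ℕP.+-suc t0 (m ∸ 1))))
          (trans ([m+n]%n≡m%n t0 m) (m<n⇒m%n≡m (ℕP.<-trans (ℕP.n<1+n t0) lt)))

  -- From the arc (t0+1,k), wrapping: the new letter t0 is positive and the
  -- comparison with f is decided by the flag.
  potential-stepˡ-wrap : ∀ t0 k fl f → suc t0 < m → 1 ≤ k → k < n → m < suc t0 + k →
    FirstLetter fl f (suc t0) k →
    prependFmaj f t0 (n ∸ k) + potential (suc k) t0 false ≡ potential k (suc t0) fl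
  potential-stepˡ-wrap t0 k@(suc k') fl f t<m 1≤k k<n wraps fr = goal
    where
    k<m = ℕP.<-trans k<n n<m
    n≤t0 : n ≤ t0
    n≤t0 = ℕP.≮⇒≥ (λ lt → ℕP.<⇒≱ wraps (subst (suc t0 + k ≤_) (sym m≡n+n) (ℕP.+-mono-≤ lt (ℕP.<⇒≤ k<n))))
    m≤ : m ≤ suc t0 + k'
    m≤ = subst (m ≤_) (ℕP.+-suc t0 k') (ℕP.≤-pred wraps)
    f<t0≡fl : ∀ fl {f} → FirstLetter fl f (suc t0) k → (f <ᵇ t0) ≡ fl
    f<t0≡fl false refl = <ᵇ-f (ℕP.n≤1+n t0)
    f<t0≡fl true  refl =
      trans (cong (_<ᵇ t0) (shift-hi {suc t0} {k'} m≤ t<m (ℕP.<-trans (ℕP.n<1+n k') k<m)))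
            (<ᵇ-t (subst (λ z → z ∸ m < t0) (ℕP.+-suc t0 k') (wrapped<start t0 k k<m (ℕP.≤-pred wraps))))
    goal : prependFmaj f t0 (n ∸ k) + potential (suc k) t0 false ≡ potential k (suc t0) fl
    goal rewrite f<t0≡fl fl fr | <ᵇ-f n≤t0
               | potential-wrap {suc k} {t0} false (subst (m <_) (sym (ℕP.+-suc t0 k)) wraps)
               | potential-wrap {k} {suc t0} fl wraps
      = trans (ℕP.+-identityʳ _) (trans (ℕP.+-identityʳ _) (2*-if fl (n ∸ k)))

  firstLetter-≥ : ∀ t k fl f → 1 ≤ k → t + k ≤ m → FirstLetter fl f t k → t ≤ f
  firstLetter-≥ t k       false f _ _      refl = ℕP.≤-refl
  firstLetter-≥ t (suc k) true  f _ inside refl =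
    subst (t ≤_) (sym (shift-lo {t} {k} (subst (_≤ m) (ℕP.+-suc t k) inside))) (ℕP.m≤m+n t k)

  -- From the arc (t0+1,k), not wrapping: no descent is created, and the
  -- potential changes according to the region of t0.
  potential-stepˡ-inside : ∀ t0 k fl f → 1 ≤ k → k < n → suc t0 + k ≤ m →
    FirstLetter fl f (suc t0) k →
    prependFmaj f t0 (n ∸ k) + potential (suc k) t0 false ≡ potential k (suc t0) fl
  potential-stepˡ-inside t0 k fl f 1≤k k<n inside fr = goal
    where
    r0 = n ∸ suc k
    hr : n ∸ k ≡ suc r0
    hr = n∸k≡suc k<n
    inside' : t0 + suc k ≤ m
    inside' = subst (_≤ m) (sym (ℕP.+-suc t0 k)) inside
    noDescent : (f <ᵇ t0) ≡ false
    noDescent = <ᵇ-f (ℕP.≤-trans (ℕP.n≤1+n t0) (firstLetter-≥ (suc t0) k fl f 1≤k inside fr))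
    goal : prependFmaj f t0 (n ∸ k) + potential (suc k) t0 false ≡ potential k (suc t0) fl
    goal rewrite noDescent with ℕP.≤-<-connex t0 r0
    ... | inj₁ le rewrite <ᵇ-t (ℕP.≤-<-trans le (s≤s (ℕP.m∸n≤m n' k)))
          | potential-lo {suc k} {t0} false inside' le
          | potential-lo {k} {suc t0} fl inside (subst (suc t0 ≤_) (sym hr) (s≤s le)) | hr = begin
        suc (2 * r0 ∸ t0)        ≡⟨ ℕP.+-∸-assoc 1 (ℕP.≤-trans le (ℕP.m≤m+n r0 (r0 + 0))) ⟨
        suc (r0 + (r0 + 0)) ∸ t0 ≡⟨ cong (_∸ t0) (ℕP.+-suc r0 (r0 + 0)) ⟨
        r0 + suc (r0 + 0) ∸ t0   ∎
      where open ≡-Reasoning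
    ... | inj₂ gt with ℕP.<-cmp t0 n
    ...   | tri< lt _ _ rewrite <ᵇ-t lt | potential-mid {suc k} {t0} false inside' gt (ℕP.<⇒≤ lt)
            | potential-mid {k} {suc t0} fl inside (subst (_< suc t0) (sym hr) (s≤s gt)) lt = sym hr
    ...   | tri≈ _ refl _ rewrite <ᵇ-f (ℕP.≤-refl {n}) | potential-mid {suc k} {n} false inside' gt ℕP.≤-refl
            | potential-hi {k} {suc n} fl inside (ℕP.n<1+n n) | hr =
      sym (trans (cong (_∸ suc n) (ℕP.+-suc n r0)) (ℕP.m+n∸m≡n n r0))
    ...   | tri> _ _ gt2 rewrite <ᵇ-f (ℕP.<⇒≤ gt2) | potential-hi {suc k} {t0} false inside' gt2
            | potential-hi {k} {suc t0} fl inside (ℕP.<-trans gt2 (ℕP.n<1+n t0)) | hr =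
      cong (_∸ suc t0) (sym (ℕP.+-suc n r0))

  potential-stepˡ : ∀ t k fl f → t < m → 1 ≤ k → k < n → FirstLetter fl f t k → StepˡGoal t k fl f
  potential-stepˡ zero     k fl f _   = potential-stepˡ-0 k fl f
  potential-stepˡ (suc t0) k fl f t<m 1≤k k<n fr rewrite shift-suc-back t0 t<m with <ᵇ-dec m (suc t0 + k)
  ... | inj₁ (wraps , _)  = potential-stepˡ-wrap t0 k fl f t<m 1≤k k<n wraps fr
  ... | inj₂ (inside , _) = potential-stepˡ-inside t0 k fl f 1≤k k<n inside fr

  firstLetter<new : ∀ t k fl f → 1 ≤ k → t + k < m → FirstLetter fl f t k → (f <ᵇ shift t k) ≡ true
  firstLetter<new t (suc k) false f _ lt refl =
    trans (cong (t <ᵇ_) (shift-lo {t} {suc k} lt))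
          (<ᵇ-t (subst (t <_) (sym (ℕP.+-suc t k)) (s≤s (ℕP.m≤m+n t k))))
  firstLetter<new t (suc k) true  f _ lt refl =
    trans (cong₂ _<ᵇ_ (shift-lo {t} {k} (ℕP.<-trans (ℕP.+-monoʳ-< t (ℕP.n<1+n k)) lt)) (shift-lo {t} {suc k} lt))
          (<ᵇ-t (ℕP.+-monoʳ-< t (ℕP.n<1+n k)))

  firstLetter<new-wrap : ∀ t k fl f → 1 ≤ k → t < m → k < m → m < t + k → FirstLetter fl f t k →
    (f <ᵇ shift t k) ≡ fl
  firstLetter<new-wrap t k false f _ t<m k<m wraps refl =
    trans (cong (t <ᵇ_) (shift-hi {t} {k} (ℕP.<⇒≤ wraps) t<m k<m))
          (<ᵇ-f (ℕP.<⇒≤ (wrapped<start t k k<m (ℕP.<⇒≤ wraps))))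
  firstLetter<new-wrap t (suc k) true f _ t<m k<m wraps refl =
    trans (cong₂ _<ᵇ_ (shift-hi {t} {k} m≤ t<m (ℕP.<-trans (ℕP.n<1+n k) k<m)) (shift-hi {t} {suc k} (ℕP.<⇒≤ wraps) t<m k<m))
          (<ᵇ-t (subst (t + k ∸ m <_) (trans (sym (ℕP.+-∸-assoc 1 m≤)) (cong (_∸ m) (sym (ℕP.+-suc t k))))
                       (ℕP.n<1+n (t + k ∸ m))))
    where
    m≤ : m ≤ t + k
    m≤ = ℕP.≤-pred (subst (m <_) (ℕP.+-suc t k) wraps)

  n≡r+k : ∀ {k} → k < n → n ≡ suc (n ∸ suc k) + k
  n≡r+k {k} k<n = trans (sym (ℕP.m∸n+n≡m (ℕP.<⇒≤ k<n))) (cong (_+ k) (n∸k≡suc k<n))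

  inside-suc : ∀ {t k} → t + k < m → t + suc k ≤ m
  inside-suc {t} {k} lt = subst (_≤ m) (sym (ℕP.+-suc t k)) lt

  potential-stepʳ-lo : ∀ t k fl f → k < n → t + k < m → (f <ᵇ t + k) ≡ true → t ≤ n ∸ suc k →
    StepʳGoal t k fl f (t + k)
  potential-stepʳ-lo t k fl f k<n lt descent le = goal
    where
    r0 = n ∸ suc k
    hr = n∸k≡suc k<n
    X = 2 * r0 ∸ t
    2r0+2-t : 2 * suc r0 ∸ t ≡ 2 + X
    2r0+2-t = begin
      2 * suc r0 ∸ t       ≡⟨ cong (_∸ t) (arith-F r0) ⟩
      2 + 2 * r0 ∸ t       ≡⟨ cong (λ z → 2 + z ∸ t) (ℕP.m+[n∸m]≡n (ℕP.≤-trans le (ℕP.m≤m+n r0 (r0 + 0)))) ⟨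
      2 + (t + X) ∸ t      ≡⟨ cong (_∸ t) (trans (sym (ℕP.+-assoc 2 t X)) (trans (cong (_+ X) (ℕP.+-comm 2 t)) (ℕP.+-assoc t 2 X))) ⟩
      t + (2 + X) ∸ t      ≡⟨ ℕP.m+n∸m≡n t (2 + X) ⟩
      2 + X                ∎
      where open ≡-Reasoning
    goal : StepʳGoal t k fl f (t + k)
    goal rewrite descent | <ᵇ-t (subst (t + k <_) (sym (n≡r+k k<n)) (ℕP.+-monoˡ-< k (s≤s le)))
               | potential-lo {suc k} {t} true (inside-suc lt) le
               | potential-lo {k} {t} fl (ℕP.<⇒≤ lt) (subst (t ≤_) (sym hr) (ℕP.≤-trans le (ℕP.n≤1+n r0))) | hr =
      trans (arith-A r0 X) (cong (_+ (r0 + suc (r0 + 0))) (sym 2r0+2-t))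

  potential-stepʳ-mid : ∀ t k fl f → k < n → t + k < m → (f <ᵇ t + k) ≡ true → n ∸ suc k < t → t ≤ n →
    StepʳGoal t k fl f (t + k)
  potential-stepʳ-mid t k fl f k<n lt descent gt t≤n = goal
    where
    r0 = n ∸ suc k
    hr = n∸k≡suc k<n
    old : potential k t fl ≡ suc r0
    old with ℕP.m≤n⇒m<n∨m≡n gt
    ... | inj₂ refl = trans (potential-lo {k} {suc r0} fl (ℕP.<⇒≤ lt) (subst (suc r0 ≤_) (sym hr) ℕP.≤-refl))
                            (trans (cong (λ z → 2 * z ∸ suc r0) hr)
                                   (trans (ℕP.m+n∸m≡n (suc r0) (suc r0 + 0)) (ℕP.+-identityʳ (suc r0))))
    ... | inj₁ lt2 = trans (potential-mid {k} {t} fl (ℕP.<⇒≤ lt) (subst (_< t) (sym hr) lt2) t≤n) hr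
    goal : StepʳGoal t k fl f (t + k)
    goal rewrite descent | <ᵇ-f (subst (_≤ t + k) (sym (n≡r+k k<n)) (ℕP.+-monoˡ-≤ k gt))
               | potential-mid {suc k} {t} true (inside-suc lt) gt t≤n | old | hr = arith-B r0

  potential-stepʳ-hi : ∀ t k fl f → k < n → t + k < m → (f <ᵇ t + k) ≡ true → n < t →
    StepʳGoal t k fl f (t + k)
  potential-stepʳ-hi t k fl f k<n lt descent n<t = goal
    where
    r0 = n ∸ suc k
    Y = n + r0 ∸ t
    t≤ : t ≤ n + r0
    t≤ = ℕP.≤-pred (ℕP.+-cancelʳ-< k t (suc (n + r0)) (subst (t + k <_) m≡ lt))
      where
      m≡ : m ≡ suc (n + r0) + k
      m≡ = trans m≡n+n (trans (cong (n +_) (n≡r+k k<n))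
                              (trans (sym (ℕP.+-assoc n (suc r0) k)) (cong (_+ k) (ℕP.+-suc n r0))))
    goal : StepʳGoal t k fl f (t + k)
    goal rewrite descent | <ᵇ-f (ℕP.≤-trans (ℕP.<⇒≤ n<t) (ℕP.m≤m+n t k))
               | potential-hi {suc k} {t} true (inside-suc lt) n<t | potential-hi {k} {t} fl (ℕP.<⇒≤ lt) n<t
               | n∸k≡suc k<n =
      trans (arith-C r0 Y)
            (cong (_+ (r0 + suc (r0 + 0))) (sym (trans (cong (_∸ t) (ℕP.+-suc n r0)) (ℕP.+-∸-assoc 1 t≤))))

  potential-stepʳ-inside : ∀ t k fl f → k < n → t + k < m → (f <ᵇ t + k) ≡ true →
    StepʳGoal t k fl f (t + k)
  potential-stepʳ-inside t k fl f k<n lt descent with ℕP.≤-<-connex t (n ∸ suc k) | ℕP.≤-<-connex t n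
  ... | inj₁ le | _         = potential-stepʳ-lo  t k fl f k<n lt descent le
  ... | inj₂ gt | inj₁ t≤n  = potential-stepʳ-mid t k fl f k<n lt descent gt t≤n
  ... | inj₂ _  | inj₂ n<t  = potential-stepʳ-hi  t k fl f k<n lt descent n<t

  potential-stepʳ-to0 : ∀ t k fl f → k < n → t + k ≡ m → StepʳGoal t k fl f 0
  potential-stepʳ-to0 t k fl f k<n t+k≡m = goal
    where
    hr = n∸k≡suc k<n
    t≡ : t ≡ n + (n ∸ k)
    t≡ = ℕP.+-cancelʳ-≡ k t (n + (n ∸ k))
      (trans t+k≡m (trans m≡n+n (trans (cong (n +_) (sym (ℕP.m∸n+n≡m (ℕP.<⇒≤ k<n))))
                                       (sym (ℕP.+-assoc n (n ∸ k) k)))))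
    n<t : n < t
    n<t = subst (n <_) (sym t≡) (subst (λ z → n < n + z) (sym hr) (ℕP.m<m+n n (s≤s z≤n)))
    wraps : m < t + suc k
    wraps = subst (m <_) (sym (trans (ℕP.+-suc t k) (cong suc t+k≡m))) (ℕP.n<1+n m)
    final : 1 + 2 * (n ∸ suc k) ≡ n + (n ∸ k) ∸ t + (2 * (n ∸ k) ∸ 1)
    final rewrite sym t≡ | ℕP.n∸n≡0 t | hr = arith-D (n ∸ suc k)
    goal : StepʳGoal t k fl f 0
    goal rewrite potential-wrap {suc k} {t} true wraps
               | potential-hi {k} {t} fl (ℕP.≤-reflexive t+k≡m) n<t = final

  -- The arc (t,k) wraps past 0: the new letter is small and negative.
  potential-stepʳ-wrap : ∀ t k fl f → t < m → 1 ≤ k → k < n → m < t + k → FirstLetter fl f t k →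
    StepʳGoal t k fl f (t + k ∸ m)
  potential-stepʳ-wrap t k@(suc k') fl f t<m 1≤k k<n wraps fr = goal
    where
    hr = n∸k≡suc k<n
    k<m = ℕP.<-trans k<n n<m
    descent : (f <ᵇ (t + k ∸ m)) ≡ fl
    descent = trans (cong (f <ᵇ_) (sym (shift-hi {t} {k} (ℕP.<⇒≤ wraps) t<m k<m)))
                    (firstLetter<new-wrap t k fl f 1≤k t<m k<m wraps fr)
    negative : t + k ∸ m < n
    negative = ℕP.<-trans (ℕP.m<n+o⇒m∸n<o (t + k) m (ℕP.+-monoˡ-< k t<m)) k<n
    wraps' : m < t + suc k
    wraps' = ℕP.<-trans wraps (subst (t + k <_) (sym (ℕP.+-suc t k)) (ℕP.n<1+n (t + k)))
    byFlag : ∀ b → 2 * (if b then n ∸ k else 0) + 1 + 2 * (n ∸ suc k)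
                   ≡ (if b then 2 * (n ∸ k) else 0) + (2 * (n ∸ k) ∸ 1)
    byFlag true  rewrite hr = arith-E (n ∸ suc k)
    byFlag false rewrite hr = arith-D (n ∸ suc k)
    goal : StepʳGoal t k fl f (t + k ∸ m)
    goal rewrite descent | <ᵇ-t negative | potential-wrap {suc k} {t} true wraps'
               | potential-wrap {k} {t} fl wraps = byFlag fl

  potential-stepʳ : ∀ t k fl f → t < m → 1 ≤ k → k < n → FirstLetter fl f t k → StepʳGoal t k fl f (shift t k)
  potential-stepʳ t k fl f t<m 1≤k k<n fr with ℕP.<-cmp (t + k) m
  ... | tri< lt _ _ = subst (StepʳGoal t k fl f) (sym (shift-lo {t} {k} lt))
    (potential-stepʳ-inside t k fl f k<n lt
      (trans (cong (f <ᵇ_) (sym (shift-lo {t} {k} lt))) (firstLetter<new t k fl f 1≤k lt fr)))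
  ... | tri≈ _ eq _ = subst (StepʳGoal t k fl f) (sym (trans (cong (_% m) eq) (n%n≡0 m)))
    (potential-stepʳ-to0 t k fl f k<n eq)
  ... | tri> _ _ gt = subst (StepʳGoal t k fl f) (sym (shift-hi {t} {k} (ℕP.<⇒≤ gt) t<m (ℕP.<-trans k<n n<m)))
    (potential-stepʳ-wrap t k fl f t<m 1≤k k<n gt fr)

-- Proof: suffixFmaj + potential is invariant along the
-- construction up to the right-step weights, equals 2n-1-p at the start,
-- and the potential vanishes at the end.
module FmajFormula (n' : ℕ) where

  open import Defs
  open Comparisons
  open Circle n'
  open LetterStatistics n'
  open ArcEnumeration n' using (arcStart; newLetter; arcWord; arcPerm; arcStart<m)
  open FmajPotential n'
  open import Data.Bool using (Bool; true; false; if_then_else_)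
  open import Data.Nat using (ℕ; zero; suc; _<_; _≤_; _∸_; _+_; _*_; s≤s; z≤n; _<ᵇ_)
  import Data.Nat.Properties as ℕP
  open import Data.List using (List; []; _∷_; map; length)
  open import Data.Sum using (inj₁; inj₂)
  open import Data.Product using (_,_)
  open import Relation.Binary.PropositionalEquality
  open import Relation.Binary.Definitions using (tri<; tri≈; tri>)
  open import Data.Nat.Tactic.RingSolver using (solve-∀)

  -- fmaj contribution of a suffix of length k (its letters sit at the
  -- indices n-k+1,…,n of the final word).
  suffixFmaj : ℕ → List ℕ → ℕ
  suffixFmaj k ps = 2 * majP (suc (n ∸ k)) ps + negP ps

  rightSum : (ℕ → ℕ) → List Bool → ℕ
  rightSum g []      = 0
  rightSum g (b ∷ e) = (if b then g (n ∸ suc (length e)) else 0) + rightSum g e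

  oddExp : ℕ → ℕ
  oddExp i = 2 * i ∸ 1

  lastStepRight : List Bool → Bool
  lastStepRight []      = false
  lastStepRight (b ∷ _) = b

  headP : List ℕ → ℕ
  headP []      = 0
  headP (x ∷ _) = x

  firstLetter-arcWord : ∀ p e → FirstLetter (lastStepRight e) (headP (arcWord p e)) (arcStart p e) (suc (length e))
  firstLetter-arcWord p []          = refl
  firstLetter-arcWord p (false ∷ e) = refl
  firstLetter-arcWord p (true ∷ e)  = refl

  suffixFmaj-cons : ∀ k q f rest X → k < n →
    suffixFmaj (suc k) (q ∷ f ∷ rest) + X ≡ suffixFmaj k (f ∷ rest) + (prependFmaj f q (n ∸ k) + X)
  suffixFmaj-cons k q f rest X k<n rewrite n∸k≡suc k<n =
    rearrange (if f <ᵇ q then suc (n ∸ suc k) else 0) (majP (suc (suc (n ∸ suc k))) (f ∷ rest))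
              (if q <ᵇ n then 1 else 0) (negP (f ∷ rest)) X
    where
    rearrange : ∀ a b c d x → 2 * (a + b) + (c + d) + x ≡ 2 * b + d + (2 * a + c + x)
    rearrange = solve-∀

  suffixFmaj-prepend : ∀ p e q X → suc (length e) < n →
    suffixFmaj (suc (suc (length e))) (q ∷ arcWord p e) + X
      ≡ suffixFmaj (suc (length e)) (arcWord p e) + (prependFmaj (headP (arcWord p e)) q (n ∸ suc (length e)) + X)
  suffixFmaj-prepend p []      q X = suffixFmaj-cons 1 q p [] X
  suffixFmaj-prepend p (b ∷ e) q X = suffixFmaj-cons (suc (suc (length e))) q (newLetter p b e) (arcWord p e) X

  potential-start : ∀ p → p < m → (if p <ᵇ n then 1 else 0) + 0 + potential 1 p false ≡ m ∸ suc p
  potential-start p p<m with ℕP.<-cmp p n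
  ... | tri< lt _ _ rewrite <ᵇ-t lt | potential-lo {1} {p} false (subst (_≤ m) (ℕP.+-comm 1 p) p<m) (ℕP.≤-pred lt) =
    trans (sym (ℕP.+-∸-assoc 1 (ℕP.≤-trans (ℕP.≤-pred lt) (ℕP.m≤m+n n' (n' + 0)))))
          (cong (_∸ p) (sym (ℕP.+-suc n' (n' + 0))))
  ... | tri≈ _ refl _ rewrite <ᵇ-f (ℕP.≤-refl {n})
                            | potential-mid {1} {n} false (subst (_≤ m) (ℕP.+-comm 1 n) n<m) (ℕP.n<1+n n') ℕP.≤-refl =
    sym (trans (cong (λ z → n' + suc z ∸ suc n') (ℕP.+-identityʳ n')) (ℕP.m+n∸n≡m n' (suc n')))
  ... | tri> _ _ gt rewrite <ᵇ-f (ℕP.<⇒≤ gt) | potential-hi {1} {p} false (subst (_≤ m) (ℕP.+-comm 1 p) p<m) gt =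
    cong (_∸ p) (sym (trans (ℕP.+-suc n' (n' + 0)) (cong (λ z → suc (n' + z)) (ℕP.+-identityʳ n'))))

  potential-full : ∀ t fl → t < m → potential n t fl ≡ 0
  potential-full t fl t<m with <ᵇ-dec m (t + n)
  ... | inj₁ (wraps , _) rewrite potential-wrap {n} {t} fl wraps | ℕP.n∸n≡0 n with fl
  ...   | true  = refl
  ...   | false = refl
  potential-full t fl t<m | inj₂ (inside , _) with ℕP.<-cmp t n
  ... | tri> _ _ gt = trans (potential-hi {n} {t} fl inside gt)
    (ℕP.m≤n⇒m∸n≡0 (subst (_≤ t) (sym (trans (cong (n +_) (ℕP.n∸n≡0 n)) (ℕP.+-identityʳ n))) (ℕP.<⇒≤ gt)))
  ... | tri≈ _ eq _ = trans (potential-mid {n} {t} fl inside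
    (subst (_< t) (sym (ℕP.n∸n≡0 n)) (subst (0 <_) (sym eq) (s≤s z≤n))) (ℕP.≤-reflexive eq)) (ℕP.n∸n≡0 n)
  ... | tri< lt _ _ with t
  ...   | zero   = trans (potential-lo {n} {0} fl inside z≤n) (cong (2 *_) (ℕP.n∸n≡0 n))
  ...   | suc t0 = trans (potential-mid {n} {suc t0} fl inside (subst (_< suc t0) (sym (ℕP.n∸n≡0 n)) (s≤s z≤n)) (ℕP.<⇒≤ lt))
                         (ℕP.n∸n≡0 n)

  fmaj-invariant : ∀ p e → p < m → suc (length e) ≤ n →
    suffixFmaj (suc (length e)) (arcWord p e) + potential (suc (length e)) (arcStart p e) (lastStepRight e)
      ≡ (m ∸ suc p) + rightSum oddExp e
  fmaj-invariant p []          p<m _   = trans (potential-start p p<m) (sym (ℕP.+-identityʳ _))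
  fmaj-invariant p (false ∷ e) p<m k<n = begin
      suffixFmaj (suc k) (q ∷ ps) + potential (suc k) q false      ≡⟨ suffixFmaj-prepend p e q _ k<n ⟩
      S + (prependFmaj f q (n ∸ k) + potential (suc k) q false)   ≡⟨ cong (S +_) (potential-stepˡ t k (lastStepRight e) f
                                                                       (arcStart<m p e p<m) (s≤s z≤n) k<n (firstLetter-arcWord p e)) ⟩
      S + potential k t (lastStepRight e)                         ≡⟨ fmaj-invariant p e p<m (ℕP.<⇒≤ k<n) ⟩
      (m ∸ suc p) + rightSum oddExp e                             ∎
    where
    open ≡-Reasoning
    k = suc (length e)
    ps = arcWord p e
    t = arcStart p e
    f = headP ps
    q = shift t (m ∸ 1)
    S = suffixFmaj k ps
  fmaj-invariant p (true ∷ e) p<m k<n = begin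
      suffixFmaj (suc k) (q ∷ ps) + potential (suc k) t true      ≡⟨ suffixFmaj-prepend p e q _ k<n ⟩
      S + (prependFmaj f q (n ∸ k) + potential (suc k) t true)   ≡⟨ cong (S +_) (potential-stepʳ t k (lastStepRight e) f
                                                                      (arcStart<m p e p<m) (s≤s z≤n) k<n (firstLetter-arcWord p e)) ⟩
      S + (potential k t (lastStepRight e) + w)                  ≡⟨ ℕP.+-assoc S _ w ⟨
      (S + potential k t (lastStepRight e)) + w                  ≡⟨ cong (_+ w) (fmaj-invariant p e p<m (ℕP.<⇒≤ k<n)) ⟩
      ((m ∸ suc p) + rightSum oddExp e) + w                      ≡⟨ ℕP.+-assoc (m ∸ suc p) _ w ⟩
      (m ∸ suc p) + (rightSum oddExp e + w)                      ≡⟨ cong ((m ∸ suc p) +_) (ℕP.+-comm (rightSum oddExp e) w) ⟩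
      (m ∸ suc p) + rightSum oddExp (true ∷ e)                   ∎
    where
    open ≡-Reasoning
    k = suc (length e)
    ps = arcWord p e
    t = arcStart p e
    f = headP ps
    q = shift t k
    w = oddExp (n ∸ k)
    S = suffixFmaj k ps

  fmaj-arcPerm : ∀ p e → p < m → length e ≡ n' → fmaj n (arcPerm p e) ≡ (m ∸ suc p) + rightSum oddExp e
  fmaj-arcPerm p e p<m refl = begin
      fmaj n (map letter ps)            ≡⟨ fmaj-letters ps ⟩
      2 * majP 1 ps + negP ps           ≡⟨ cong (λ z → 2 * majP (suc z) ps + negP ps) (ℕP.n∸n≡0 n) ⟨
      suffixFmaj n ps                   ≡⟨ ℕP.+-identityʳ _ ⟨
      suffixFmaj n ps + 0               ≡⟨ cong (suffixFmaj n ps +_) (potential-full (arcStart p e) (lastStepRight e) (arcStart<m p e p<m)) ⟨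
      suffixFmaj n ps + potential n (arcStart p e) (lastStepRight e) ≡⟨ fmaj-invariant p e p<m ℕP.≤-refl ⟩
      (m ∸ suc p) + rightSum oddExp e   ∎
    where
    open ≡-Reasoning
    ps = arcWord p e

module Parity where

  open import Defs using (negOnePow)
  open import Data.Bool using (Bool; true; false; not; _∧_; _xor_; if_then_else_)
  import Data.Bool.Properties as BoolP
  open import Data.Nat using (ℕ; zero; suc; _≤_; _+_; _*_; _∸_)
  import Data.Nat.Properties as ℕP
  open import Data.Integer as ℤ using ()
  import Data.Integer.Properties as ℤP
  open import Relation.Binary.PropositionalEquality

  par : ℕ → Bool
  par zero    = false
  par (suc x) = not (par x)

  par-+ : ∀ a b → par (a + b) ≡ par a xor par b
  par-+ zero    b = refl
  par-+ (suc a) b = trans (cong not (par-+ a b)) (BoolP.not-distribˡ-xor (par a) (par b))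

  par-* : ∀ a b → par (a * b) ≡ par a ∧ par b
  par-* zero    b = refl
  par-* (suc a) b = trans (par-+ b (a * b)) (trans (cong (par b xor_) (par-* a b)) (table (par a) (par b)))
    where
    table : ∀ x y → y xor (x ∧ y) ≡ not x ∧ y
    table true  true  = refl
    table true  false = refl
    table false true  = refl
    table false false = refl

  par-∸ : ∀ a b → b ≤ a → par (a ∸ b) ≡ par a xor par b
  par-∸ a b b≤a = begin
      par (a ∸ b)                        ≡⟨ BoolP.xor-identityʳ _ ⟨
      par (a ∸ b) xor false              ≡⟨ cong (par (a ∸ b) xor_) (BoolP.xor-same (par b)) ⟨
      par (a ∸ b) xor (par b xor par b)  ≡⟨ BoolP.xor-assoc (par (a ∸ b)) (par b) (par b) ⟨
      (par (a ∸ b) xor par b) xor par b  ≡⟨ cong (_xor par b) (par-+ (a ∸ b) b) ⟨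
      par (a ∸ b + b) xor par b          ≡⟨ cong (λ z → par z xor par b) (ℕP.m∸n+n≡m b≤a) ⟩
      par a xor par b                    ∎
    where open ≡-Reasoning

  negOnePow-+ : ∀ a b → negOnePow (a + b) ≡ negOnePow a ℤ.* negOnePow b
  negOnePow-+ zero    b = sym (ℤP.*-identityˡ (negOnePow b))
  negOnePow-+ (suc a) b = trans (cong ℤ.-_ (negOnePow-+ a b)) (ℤP.neg-distribˡ-* (negOnePow a) (negOnePow b))

  negOnePow-^ : ∀ a j → negOnePow a ℤ.^ j ≡ negOnePow (a * j)
  negOnePow-^ a zero    = cong negOnePow (sym (ℕP.*-zeroʳ a))
  negOnePow-^ a (suc j) = trans (cong (negOnePow a ℤ.*_) (negOnePow-^ a j))
    (trans (sym (negOnePow-+ a (a * j))) (cong negOnePow (sym (ℕP.*-suc a j))))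

  negOnePow-par : ∀ a → negOnePow a ≡ (if par a then ℤ.- (ℤ.+ 1) else ℤ.+ 1)
  negOnePow-par zero = refl
  negOnePow-par (suc a) rewrite negOnePow-par a with par a
  ... | true  = refl
  ... | false = refl

  negOnePow-≡ : ∀ a b → par a ≡ par b → negOnePow a ≡ negOnePow b
  negOnePow-≡ a b e = trans (negOnePow-par a)
    (trans (cong (λ z → if z then ℤ.- (ℤ.+ 1) else ℤ.+ 1) e) (sym (negOnePow-par b)))

module Counting where

  open import Data.Bool using (Bool; if_then_else_)
  open import Data.Nat using (ℕ; zero; suc; _<_; _≤_; _+_; _∸_; _<?_)
  import Data.Nat.Properties as ℕP
  open import Relation.Nullary using (Dec; yes; no)
  open import Relation.Binary.PropositionalEquality

  ind : Bool → ℕ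
  ind b = if b then 1 else 0

  Σℕ : ℕ → (ℕ → ℕ) → ℕ
  Σℕ zero    h = 0
  Σℕ (suc k) h = Σℕ k h + h k

  Σℕ-head : ∀ k h → Σℕ (suc k) h ≡ h 0 + Σℕ k (λ d → h (suc d))
  Σℕ-head zero    h = sym (ℕP.+-identityʳ (h 0))
  Σℕ-head (suc k) h = trans (cong (_+ h (suc k)) (Σℕ-head k h)) (ℕP.+-assoc (h 0) _ _)

  Σℕ-cong : ∀ k {h g : ℕ → ℕ} → (∀ d → d < k → h d ≡ g d) → Σℕ k h ≡ Σℕ k g
  Σℕ-cong zero    e = refl
  Σℕ-cong (suc k) e = cong₂ _+_ (Σℕ-cong k (λ d lt → e d (ℕP.m<n⇒m<1+n lt))) (e k ℕP.≤-refl)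

  count-threshold : ∀ a k (h : ℕ → ℕ) →
    (∀ d → d < k → d < a → h d ≡ 0) → (∀ d → d < k → a ≤ d → h d ≡ 1) → Σℕ k h ≡ k ∸ a
  count-threshold a zero    h h0 h1 = sym (ℕP.0∸n≡0 a)
  count-threshold a (suc k) h h0 h1 = step (k <? a)
    where
    ih : Σℕ k h ≡ k ∸ a
    ih = count-threshold a k h (λ d lt → h0 d (ℕP.m<n⇒m<1+n lt)) (λ d lt → h1 d (ℕP.m<n⇒m<1+n lt))
    step : Dec (k < a) → Σℕ k h + h k ≡ suc k ∸ a
    step (yes k<a) = trans (cong₂ _+_ ih (h0 k ℕP.≤-refl k<a))
      (trans (ℕP.+-identityʳ _) (trans (ℕP.m≤n⇒m∸n≡0 (ℕP.<⇒≤ k<a)) (sym (ℕP.m≤n⇒m∸n≡0 k<a))))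
    step (no k≮a) = trans (cong₂ _+_ ih (h1 k ℕP.≤-refl (ℕP.≮⇒≥ k≮a)))
      (trans (ℕP.+-comm (k ∸ a) 1) (sym (ℕP.+-∸-assoc 1 (ℕP.≮⇒≥ k≮a))))

-- Absolute values
-- are positions mod n, so prepending a letter adds the number of letters
-- of the arc whose position mod n is smaller (countBelow), which is
-- computed explicitly.  As for fmaj, the proof runs through an invariant
-- corrected by a parity defect depending only on k and t mod n, which
-- vanishes for the full arc.
module InversionParity (n' : ℕ) where

  open import Defs
  open Comparisons
  open Parity
  open Counting
  open Circle n'
  open LetterStatistics n' using (countAbs; invAbs)
  open ArcEnumeration n' using (arcStart; arcWord)
  open FmajFormula n' using (rightSum)
  open import Data.Bool using (Bool; true; false; if_then_else_; _∧_; not; _xor_)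
  import Data.Bool.Properties as BoolP
  open import Data.Nat using (ℕ; zero; suc; _<_; _≤_; _∸_; _+_; _*_; s≤s; z≤n; _<ᵇ_; _≡ᵇ_; _%_)
  import Data.Nat.Properties as ℕP
  open import Data.Nat.DivMod
  open import Data.Nat.Divisibility using (divides; _∣_)
  open import Data.List using (List; []; _∷_; length)
  open import Data.Sum using (inj₁; inj₂)
  open import Data.Product using (_,_)
  open import Relation.Binary.PropositionalEquality
  open import Relation.Binary.Definitions using (tri<; tri≈; tri>)

  xorL : ∀ a b c → (a xor b) xor c ≡ b xor (a xor c)
  xorL a b c = trans (cong (_xor c) (BoolP.xor-comm a b)) (BoolP.xor-assoc b a c)

  xorR : ∀ a b c → a xor (b xor c) ≡ (a xor c) xor b
  xorR a b c = trans (cong (a xor_) (BoolP.xor-comm b c)) (sym (BoolP.xor-assoc a c b))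

  par-m : par m ≡ false
  par-m = par-* 2 n

  n∣m : n ∣ m
  n∣m = divides 2 refl

  %n-lo : ∀ x → x < n → x % n ≡ x
  %n-lo x x<n = m<n⇒m%n≡m x<n

  %n-hi : ∀ x → n ≤ x → x < n + n → x % n ≡ x ∸ n
  %n-hi x n≤x x<2n = trans (cong (_% n) (sym (ℕP.m∸n+n≡m n≤x)))
    (trans ([m+n]%n≡m%n (x ∸ n) n) (m<n⇒m%n≡m (ℕP.m<n+o⇒m∸n<o x n x<2n)))

  [x%n+y]%n : ∀ x y → (x % n + y) % n ≡ (x + y) % n
  [x%n+y]%n x y = trans (%-distribˡ-+ (x % n) y n)
    (trans (cong (λ z → (z + y % n) % n) (m%n%n≡m%n x n)) (sym (%-distribˡ-+ x y n)))

  +%n : ∀ t d → (t + d) % n ≡ (t % n + d) % n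
  +%n t d = sym ([x%n+y]%n t d)

  absPos-% : ∀ x → x < m → absPos x ≡ x % n
  absPos-% x x<m with <ᵇ-dec x n
  ... | inj₁ (x<n , e) rewrite e = sym (%n-lo x x<n)
  ... | inj₂ (n≤x , e) rewrite e = sym (%n-hi x n≤x (subst (x <_) m≡n+n x<m))

  absPos-shift : ∀ t d → absPos (shift t d) ≡ (t + d) % n
  absPos-shift t d = trans (absPos-% (shift t d) (shift<m t d)) (m∣n⇒o%n%m≡o%m n m (t + d) n∣m)

  back%n : ∀ t → shift t (m ∸ 1) % n ≡ (t % n + (m ∸ 1)) % n
  back%n t = trans (m∣n⇒o%n%m≡o%m n m (t + (m ∸ 1)) n∣m) (+%n t (m ∸ 1))

  back-shift%n : ∀ t d → (shift t (m ∸ 1) + suc d) % n ≡ (t + d) % n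
  back-shift%n t d = begin
      (shift t (m ∸ 1) + suc d) % n     ≡⟨ [x%n+y]%n (shift t (m ∸ 1)) (suc d) ⟨
      (shift t (m ∸ 1) % n + suc d) % n ≡⟨ cong (λ z → (z + suc d) % n) (m∣n⇒o%n%m≡o%m n m (t + (m ∸ 1)) n∣m) ⟩
      ((t + (m ∸ 1)) % n + suc d) % n   ≡⟨ [x%n+y]%n (t + (m ∸ 1)) (suc d) ⟩
      (t + (m ∸ 1) + suc d) % n         ≡⟨ cong (_% n) e ⟩
      (t + d + 2 * n) % n               ≡⟨ [m+kn]%n≡m%n (t + d) 2 n ⟩
      (t + d) % n                       ∎
    where
    open ≡-Reasoning
    e : t + (m ∸ 1) + suc d ≡ t + d + 2 * n
    e = trans (ℕP.+-assoc t (m ∸ 1) (suc d))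
      (trans (cong (t +_) (trans (ℕP.+-suc (m ∸ 1) d) (ℕP.+-comm m d))) (sym (ℕP.+-assoc t d m)))

  countBelow : ℕ → ℕ → ℕ → ℕ
  countBelow t k x = Σℕ k (λ d → ind ((t + d) % n <ᵇ x))

  countAbs-arcWord : ∀ p e → p < m → suc (length e) ≤ n → ∀ x →
    countAbs x (arcWord p e) ≡ countBelow (arcStart p e) (suc (length e)) x
  countAbs-arcWord p [] p<m _ x = trans (ℕP.+-identityʳ _)
    (cong (λ z → ind (z <ᵇ x)) (trans (absPos-% p p<m) (cong (_% n) (sym (ℕP.+-identityʳ p)))))
  countAbs-arcWord p (true ∷ e) p<m k<n x =
    trans (cong₂ _+_ (cong (λ z → ind (z <ᵇ x)) (absPos-shift t k)) (countAbs-arcWord p e p<m (ℕP.<⇒≤ k<n) x))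
          (ℕP.+-comm (ind ((t + k) % n <ᵇ x)) (countBelow t k x))
    where
    t = arcStart p e
    k = suc (length e)
  countAbs-arcWord p (false ∷ e) p<m k<n x =
    trans (cong₂ _+_ (cong (λ z → ind (z <ᵇ x)) (trans (absPos-% q (shift<m t (m ∸ 1))) (cong (_% n) (sym (ℕP.+-identityʳ q)))))
                     (trans (countAbs-arcWord p e p<m (ℕP.<⇒≤ k<n) x)
                            (Σℕ-cong k (λ d _ → cong (λ z → ind (z <ᵇ x)) (sym (back-shift%n t d))))))
          (sym (Σℕ-head k (λ d → ind ((q + d) % n <ᵇ x))))
    where
    t = arcStart p e
    k = suc (length e)
    q = shift t (m ∸ 1)

  ind-t : ∀ {a b} → a < b → ind (a <ᵇ b) ≡ 1
  ind-t lt rewrite <ᵇ-t lt = refl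

  ind-f : ∀ {a b} → b ≤ a → ind (a <ᵇ b) ≡ 0
  ind-f le rewrite <ᵇ-f le = refl

  ∸< : ∀ {a b c} → b ≤ a → a < c + b → a ∸ b < c
  ∸< {a} {b} {c} le lt = ℕP.+-cancelʳ-< b (a ∸ b) c (subst (_< c + b) (sym (ℕP.m∸n+n≡m le)) lt)

  countBelowʳ : ∀ t k → k < n → countBelow t k ((t + k) % n) ≡ k ∸ (if t % n + k <ᵇ n then 0 else n ∸ t % n)
  countBelowʳ t k k<n with <ᵇ-dec (t % n + k) n
  ... | inj₁ (c+k<n , e) rewrite e = count-threshold 0 k _ (λ d _ ()) below
    where
    c = t % n
    below : ∀ d → d < k → 0 ≤ d → ind ((t + d) % n <ᵇ (t + k) % n) ≡ 1
    below d d<k _ rewrite +%n t d | +%n t k | %n-lo (c + k) c+k<n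
                        | %n-lo (c + d) (ℕP.<-trans (ℕP.+-monoʳ-< c d<k) c+k<n) = ind-t (ℕP.+-monoʳ-< c d<k)
  ... | inj₂ (n≤c+k , e) rewrite e = count-threshold (n ∸ c) k _ above below
    where
    c = t % n
    c<n : c < n
    c<n = m%n<n t n
    c≤n = ℕP.<⇒≤ c<n
    new≡ : (t + k) % n ≡ c + k ∸ n
    new≡ = trans (+%n t k) (%n-hi (c + k) n≤c+k (ℕP.+-mono-< c<n k<n))
    new<c : c + k ∸ n < c
    new<c = ∸< n≤c+k (ℕP.+-monoʳ-< c k<n)
    above : ∀ d → d < k → d < n ∸ c → ind ((t + d) % n <ᵇ (t + k) % n) ≡ 0
    above d d<k d<a rewrite new≡ | +%n t d
                          | %n-lo (c + d) (subst (c + d <_) (ℕP.m+[n∸m]≡n c≤n) (ℕP.+-monoʳ-< c d<a)) =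
      ind-f (ℕP.≤-trans (ℕP.<⇒≤ new<c) (ℕP.m≤m+n c d))
    below : ∀ d → d < k → n ∸ c ≤ d → ind ((t + d) % n <ᵇ (t + k) % n) ≡ 1
    below d d<k a≤d rewrite new≡ | +%n t d
                          | %n-hi (c + d) (subst (_≤ c + d) (ℕP.m+[n∸m]≡n c≤n) (ℕP.+-monoʳ-≤ c a≤d))
                                  (ℕP.+-mono-< c<n (ℕP.<-trans d<k k<n)) =
      ind-t (ℕP.∸-monoˡ-< (ℕP.+-monoʳ-< c d<k) (subst (_≤ c + d) (ℕP.m+[n∸m]≡n c≤n) (ℕP.+-monoʳ-≤ c a≤d)))

  m-1≡n'+n : m ∸ 1 ≡ n' + n
  m-1≡n'+n = cong (λ z → n' + suc z) (ℕP.+-identityʳ n')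

  countBelowˡ-mod : ∀ c k → c < n → k < n →
    Σℕ k (λ d → ind ((c + d) % n <ᵇ (c + (m ∸ 1)) % n)) ≡ k ∸ (if c ≡ᵇ 0 then 0 else n ∸ c)
  countBelowˡ-mod zero k c<n k<n = count-threshold 0 k _ (λ d _ ()) below
    where
    new≡ : (m ∸ 1) % n ≡ n'
    new≡ = trans (cong (_% n) m-1≡n'+n) (trans ([m+n]%n≡m%n n' n) (%n-lo n' (ℕP.n<1+n n')))
    below : ∀ d → d < k → 0 ≤ d → ind (d % n <ᵇ (m ∸ 1) % n) ≡ 1
    below d d<k _ rewrite new≡ | %n-lo d (ℕP.<-trans d<k k<n) = ind-t (ℕP.<-≤-trans d<k (ℕP.≤-pred k<n))
  countBelowˡ-mod (suc c0) k c<n k<n = count-threshold (n ∸ suc c0) k _ above below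
    where
    c = suc c0
    c≤n = ℕP.<⇒≤ c<n
    new≡ : (c + (m ∸ 1)) % n ≡ c0
    new≡ = trans (cong (_% n) (sym (ℕP.+-suc c0 (m ∸ 1))))
      (trans ([m+kn]%n≡m%n c0 2 n) (%n-lo c0 (ℕP.<-trans (ℕP.n<1+n c0) c<n)))
    above : ∀ d → d < k → d < n ∸ c → ind ((c + d) % n <ᵇ (c + (m ∸ 1)) % n) ≡ 0
    above d d<k d<a rewrite new≡ | %n-lo (c + d) (subst (c + d <_) (ℕP.m+[n∸m]≡n c≤n) (ℕP.+-monoʳ-< c d<a)) =
      ind-f (ℕP.≤-trans (ℕP.n≤1+n c0) (ℕP.m≤m+n c d))
    below : ∀ d → d < k → n ∸ c ≤ d → ind ((c + d) % n <ᵇ (c + (m ∸ 1)) % n) ≡ 1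
    below d d<k a≤d rewrite new≡ | %n-hi (c + d) (subst (_≤ c + d) (ℕP.m+[n∸m]≡n c≤n) (ℕP.+-monoʳ-≤ c a≤d))
                                                (ℕP.+-mono-< c<n (ℕP.<-trans d<k k<n)) =
      ind-t (∸< (subst (_≤ c + d) (ℕP.m+[n∸m]≡n c≤n) (ℕP.+-monoʳ-≤ c a≤d))
                (subst (_< c0 + n) (ℕP.+-suc c0 d) (ℕP.+-monoʳ-< c0 (ℕP.≤-trans (s≤s d<k) k<n))))

  countBelowˡ : ∀ t k → k < n → countBelow t k ((t + (m ∸ 1)) % n) ≡ k ∸ (if t % n ≡ᵇ 0 then 0 else n ∸ t % n)
  countBelowˡ t k k<n =
    trans (Σℕ-cong k (λ d _ → cong₂ (λ a b → ind (a <ᵇ b)) (+%n t d) (+%n t (m ∸ 1))))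
          (countBelowˡ-mod (t % n) k (m%n<n t n) k<n)

  -- The parity defect of an arc of length k whose start is c mod n; it is
  -- only used through the step identities below, which are checked by
  -- case analysis on the parities involved.
  invDefectB : Bool → Bool → Bool → Bool → Bool
  invDefectB Pn Pk Pc wraps = (not Pn ∧ (Pk xor Pc)) xor (wraps ∧ (not Pk ∧ (Pn xor Pc)))

  invDefect : ℕ → ℕ → Bool
  invDefect k c = invDefectB (par n) (par k) (par c) (n <ᵇ c + k)

  invTarget : ℕ → List Bool → ℕ
  invTarget p e = (n ∸ 1) * (m ∸ suc p) + rightSum (_∸ 1) e

  -- Truth tables behind the defect steps (n, k, c stand for their parities).
  table-ˡ-0 : ∀ n k → k xor invDefectB (not n) (not k) n true ≡ invDefectB (not n) k false false
  table-ˡ-0 true  true  = refl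
  table-ˡ-0 true  false = refl
  table-ˡ-0 false true  = refl
  table-ˡ-0 false false = refl

  table-ˡ-inside : ∀ n k c → false xor invDefectB n (not k) c false ≡ invDefectB n k (not c) false
  table-ˡ-inside true  true  c     = refl
  table-ˡ-inside true  false c     = refl
  table-ˡ-inside false true  true  = refl
  table-ˡ-inside false true  false = refl
  table-ˡ-inside false false true  = refl
  table-ˡ-inside false false false = refl

  table-ˡ-wrap : ∀ n k c → (k xor (n xor not c)) xor invDefectB n (not k) c true ≡ invDefectB n k (not c) true
  table-ˡ-wrap true  true  true  = refl
  table-ˡ-wrap true  true  false = refl
  table-ˡ-wrap true  false true  = refl
  table-ˡ-wrap true  false false = refl
  table-ˡ-wrap false true  true  = refl
  table-ˡ-wrap false true  false = refl
  table-ˡ-wrap false false true  = refl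
  table-ˡ-wrap false false false = refl

  table-ʳ-inside : ∀ n k c → k xor invDefectB n (not k) c false ≡ invDefectB n k c false xor ((n xor k) xor true)
  table-ʳ-inside true  true  c     = refl
  table-ʳ-inside true  false c     = refl
  table-ʳ-inside false true  true  = refl
  table-ʳ-inside false true  false = refl
  table-ʳ-inside false false true  = refl
  table-ʳ-inside false false false = refl

  table-ʳ-exact : ∀ k c → false xor invDefectB (k xor c) (not k) c true
                          ≡ invDefectB (k xor c) k c false xor (((k xor c) xor k) xor true)
  table-ʳ-exact true  true  = refl
  table-ʳ-exact true  false = refl
  table-ʳ-exact false true  = refl
  table-ʳ-exact false false = refl

  table-ʳ-wrap : ∀ n k c → (k xor (n xor c)) xor invDefectB n (not k) c true ≡ invDefectB n k c true xor ((n xor k) xor true)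
  table-ʳ-wrap true  true  true  = refl
  table-ʳ-wrap true  true  false = refl
  table-ʳ-wrap true  false true  = refl
  table-ʳ-wrap true  false false = refl
  table-ʳ-wrap false true  true  = refl
  table-ʳ-wrap false true  false = refl
  table-ʳ-wrap false false true  = refl
  table-ʳ-wrap false false false = refl

  [m-1]%n : (m ∸ 1) % n ≡ n'
  [m-1]%n = trans (cong (_% n) m-1≡n'+n) (trans ([m+n]%n≡m%n n' n) (%n-lo n' (ℕP.n<1+n n')))

  [c+m-1]%n : ∀ c0 → suc c0 < n → (suc c0 + (m ∸ 1)) % n ≡ c0
  [c+m-1]%n c0 c<n = trans (cong (_% n) (sym (ℕP.+-suc c0 (m ∸ 1))))
    (trans ([m+kn]%n≡m%n c0 2 n) (%n-lo c0 (ℕP.<-trans (ℕP.n<1+n c0) c<n)))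

  defect-stepˡ-0 : ∀ k → 1 ≤ k → k < n → par k xor invDefect (suc k) ((m ∸ 1) % n) ≡ invDefect k 0
  defect-stepˡ-0 k 1≤k k<n = begin
      par k xor invDefect (suc k) ((m ∸ 1) % n)
        ≡⟨ cong (λ z → par k xor invDefect (suc k) z) [m-1]%n ⟩
      par k xor invDefectB (not (par n')) (not (par k)) (par n') (n <ᵇ n' + suc k)
        ≡⟨ cong (λ z → par k xor invDefectB (not (par n')) (not (par k)) (par n') z) wraps ⟩
      par k xor invDefectB (not (par n')) (not (par k)) (par n') true
        ≡⟨ table-ˡ-0 (par n') (par k) ⟩
      invDefectB (not (par n')) (par k) false false
        ≡⟨ cong (invDefectB (not (par n')) (par k) false) (<ᵇ-f (ℕP.<⇒≤ k<n)) ⟨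
      invDefect k 0 ∎
    where
    open ≡-Reasoning
    wraps : (n <ᵇ n' + suc k) ≡ true
    wraps = <ᵇ-t (subst (n <_) (sym (ℕP.+-suc n' k)) (s≤s (subst (_≤ n' + k) (ℕP.+-comm n' 1) (ℕP.+-monoʳ-≤ n' 1≤k))))

  defect-stepˡ : ∀ c k → c < n → 1 ≤ k → k < n →
    par (k ∸ (if c ≡ᵇ 0 then 0 else n ∸ c)) xor invDefect (suc k) ((c + (m ∸ 1)) % n) ≡ invDefect k c
  defect-stepˡ zero     k c<n = defect-stepˡ-0 k
  defect-stepˡ (suc c0) k c<n 1≤k k<n with ℕP.≤-<-connex (suc c0 + k) n
  ... | inj₁ inside = begin
      par (k ∸ (n ∸ suc c0)) xor invDefect (suc k) ((suc c0 + (m ∸ 1)) % n)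
        ≡⟨ cong₂ (λ a z → par a xor invDefect (suc k) z) none ([c+m-1]%n c0 c<n) ⟩
      false xor invDefectB (par n) (not (par k)) (par c0) (n <ᵇ c0 + suc k)
        ≡⟨ cong (λ z → false xor invDefectB (par n) (not (par k)) (par c0) z) (trans (cong (n <ᵇ_) (ℕP.+-suc c0 k)) noWrap) ⟩
      false xor invDefectB (par n) (not (par k)) (par c0) false
        ≡⟨ table-ˡ-inside (par n) (par k) (par c0) ⟩
      invDefectB (par n) (par k) (not (par c0)) false
        ≡⟨ cong (invDefectB (par n) (par k) (not (par c0))) noWrap ⟨
      invDefect k (suc c0) ∎
    where
    open ≡-Reasoning
    noWrap : (n <ᵇ suc c0 + k) ≡ false
    noWrap = <ᵇ-f inside
    none : k ∸ (n ∸ suc c0) ≡ 0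
    none = ℕP.m≤n⇒m∸n≡0 (ℕP.m+n≤o⇒m≤o∸n k (subst (_≤ n) (ℕP.+-comm (suc c0) k) inside))
  ... | inj₂ wraps = begin
      par (k ∸ (n ∸ suc c0)) xor invDefect (suc k) ((suc c0 + (m ∸ 1)) % n)
        ≡⟨ cong₂ (λ a z → a xor invDefect (suc k) z) count ([c+m-1]%n c0 c<n) ⟩
      (par k xor (par n xor not (par c0))) xor invDefectB (par n) (not (par k)) (par c0) (n <ᵇ c0 + suc k)
        ≡⟨ cong (λ z → (par k xor (par n xor not (par c0))) xor invDefectB (par n) (not (par k)) (par c0) z)
                (trans (cong (n <ᵇ_) (ℕP.+-suc c0 k)) wrapT) ⟩
      (par k xor (par n xor not (par c0))) xor invDefectB (par n) (not (par k)) (par c0) true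
        ≡⟨ table-ˡ-wrap (par n) (par k) (par c0) ⟩
      invDefectB (par n) (par k) (not (par c0)) true
        ≡⟨ cong (invDefectB (par n) (par k) (not (par c0))) wrapT ⟨
      invDefect k (suc c0) ∎
    where
    open ≡-Reasoning
    wrapT : (n <ᵇ suc c0 + k) ≡ true
    wrapT = <ᵇ-t wraps
    count : par (k ∸ (n ∸ suc c0)) ≡ par k xor (par n xor not (par c0))
    count = trans (par-∸ k (n ∸ suc c0) (ℕP.m≤n+o⇒m∸n≤o n (suc c0) (ℕP.<⇒≤ wraps)))
                  (cong (par k xor_) (par-∸ n (suc c0) (ℕP.<⇒≤ c<n)))

  par-n∸k∸1 : ∀ k → k < n → par (n ∸ k ∸ 1) ≡ (par n xor par k) xor true
  par-n∸k∸1 k k<n = trans (par-∸ (n ∸ k) 1 (ℕP.m<n⇒0<n∸m k<n)) (cong (_xor true) (par-∸ n k (ℕP.<⇒≤ k<n)))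

  count-exact : ∀ c k → c + k ≡ n → k ∸ (n ∸ c) ≡ 0
  count-exact c k eq = ℕP.m≤n⇒m∸n≡0 (ℕP.m+n≤o⇒m≤o∸n k (subst (_≤ n) (ℕP.+-comm c k) (ℕP.≤-reflexive eq)))

  par-n-exact : ∀ c k → c + k ≡ n → par n ≡ par k xor par c
  par-n-exact c k eq = trans (cong par (sym eq)) (trans (par-+ c k) (BoolP.xor-comm (par c) (par k)))

  par-count-wrap : ∀ c k → c < n → n < c + k → par (k ∸ (n ∸ c)) ≡ par k xor (par n xor par c)
  par-count-wrap c k c<n gt =
    trans (par-∸ k (n ∸ c) (ℕP.m≤n+o⇒m∸n≤o n c (ℕP.<⇒≤ gt))) (cong (par k xor_) (par-∸ n c (ℕP.<⇒≤ c<n)))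

  defect-stepʳ : ∀ c k → c < n → 1 ≤ k → k < n →
    par (k ∸ (if c + k <ᵇ n then 0 else n ∸ c)) xor invDefect (suc k) c ≡ invDefect k c xor par (n ∸ k ∸ 1)
  defect-stepʳ c k c<n 1≤k k<n rewrite par-n∸k∸1 k k<n with ℕP.<-cmp (c + k) n
  ... | tri< lt _ _ rewrite <ᵇ-t lt | <ᵇ-f {n} {c + k} (ℕP.<⇒≤ lt)
                          | <ᵇ-f {n} {c + suc k} (subst (_≤ n) (sym (ℕP.+-suc c k)) lt) =
    table-ʳ-inside (par n) (par k) (par c)
  ... | tri≈ _ eq _ rewrite <ᵇ-f {c + k} {n} (ℕP.≤-reflexive (sym eq)) | <ᵇ-f {n} {c + k} (ℕP.≤-reflexive eq)
                          | <ᵇ-t {n} {c + suc k} (subst (n <_) (sym (trans (ℕP.+-suc c k) (cong suc eq))) (ℕP.n<1+n n))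
                          | count-exact c k eq | par-n-exact c k eq = table-ʳ-exact (par k) (par c)
  ... | tri> _ _ gt rewrite <ᵇ-f {c + k} {n} (ℕP.<⇒≤ gt) | <ᵇ-t {n} {c + k} gt
                          | <ᵇ-t {n} {c + suc k} (subst (n <_) (sym (ℕP.+-suc c k)) (ℕP.<-trans gt (ℕP.n<1+n (c + k))))
                          | par-count-wrap c k c<n gt = table-ʳ-wrap (par n) (par k) (par c)

  inv-parity-start : ∀ p → p < m → false xor invDefect 1 (p % n) ≡ par (invTarget p [])
  inv-parity-start p p<m rewrite <ᵇ-f {n} {p % n + 1} (subst (_≤ n) (ℕP.+-comm 1 (p % n)) (m%n<n p n))
    | par-+ ((n ∸ 1) * (m ∸ suc p)) 0 | par-* (n ∸ 1) (m ∸ suc p) | par-∸ m (suc p) p<m | par-m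
    with <ᵇ-dec p n
  ... | inj₁ (p<n , _) rewrite %n-lo p p<n with par n' | par p
  ...   | true  | true  = refl
  ...   | true  | false = refl
  ...   | false | true  = refl
  ...   | false | false = refl
  inv-parity-start p p<m | inj₂ (n≤p , _) rewrite %n-hi p n≤p (subst (p <_) m≡n+n p<m) | par-∸ p n n≤p
    with par n' | par p
  ...   | true  | true  = refl
  ...   | true  | false = refl
  ...   | false | true  = refl
  ...   | false | false = refl

  invAbs-prepend : ∀ q ps D →
    par (invAbs (q ∷ ps)) xor D ≡ par (invAbs ps) xor (par (countAbs (absPos q) ps) xor D)
  invAbs-prepend q ps D =
    trans (cong (_xor D) (par-+ (countAbs (absPos q) ps) (invAbs ps))) (xorL (par (countAbs (absPos q) ps)) (par (invAbs ps)) D)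

  invTarget-right : ∀ p e → par (invTarget p (true ∷ e)) ≡ par (invTarget p e) xor par (n ∸ suc (length e) ∸ 1)
  invTarget-right p e = begin
      par (X + (w + R))           ≡⟨ par-+ X (w + R) ⟩
      par X xor par (w + R)       ≡⟨ cong (par X xor_) (par-+ w R) ⟩
      par X xor (par w xor par R) ≡⟨ xorR (par X) (par w) (par R) ⟩
      (par X xor par R) xor par w ≡⟨ cong (_xor par w) (par-+ X R) ⟨
      par (X + R) xor par w       ∎
    where
    open ≡-Reasoning
    X = (n ∸ 1) * (m ∸ suc p)
    w = n ∸ suc (length e) ∸ 1
    R = rightSum (_∸ 1) e

  inv-parity-invariant : ∀ p e → p < m → suc (length e) ≤ n →
    par (invAbs (arcWord p e)) xor invDefect (suc (length e)) (arcStart p e % n) ≡ par (invTarget p e)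
  inv-parity-invariant p [] p<m _ = inv-parity-start p p<m
  inv-parity-invariant p (false ∷ e) p<m k<n = begin
      par (invAbs (q ∷ ps)) xor invDefect (suc k) (q % n)
        ≡⟨ cong (λ c → par (invAbs (q ∷ ps)) xor invDefect (suc k) c) (back%n t) ⟩
      par (invAbs (q ∷ ps)) xor invDefect (suc k) c'
        ≡⟨ invAbs-prepend q ps (invDefect (suc k) c') ⟩
      par (invAbs ps) xor (par (countAbs (absPos q) ps) xor invDefect (suc k) c')
        ≡⟨ cong (λ z → par (invAbs ps) xor (par z xor invDefect (suc k) c')) below ⟩
      par (invAbs ps) xor (par (k ∸ (if t % n ≡ᵇ 0 then 0 else n ∸ t % n)) xor invDefect (suc k) c')
        ≡⟨ cong (par (invAbs ps) xor_) (defect-stepˡ (t % n) k (m%n<n t n) (s≤s z≤n) k<n) ⟩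
      par (invAbs ps) xor invDefect k (t % n)
        ≡⟨ inv-parity-invariant p e p<m (ℕP.<⇒≤ k<n) ⟩
      par (invTarget p e) ∎
    where
    open ≡-Reasoning
    ps = arcWord p e
    t = arcStart p e
    k = suc (length e)
    q = shift t (m ∸ 1)
    c' = (t % n + (m ∸ 1)) % n
    below : countAbs (absPos q) ps ≡ k ∸ (if t % n ≡ᵇ 0 then 0 else n ∸ t % n)
    below = trans (countAbs-arcWord p e p<m (ℕP.<⇒≤ k<n) (absPos q))
                  (trans (cong (countBelow t k) (absPos-shift t (m ∸ 1))) (countBelowˡ t k k<n))
  inv-parity-invariant p (true ∷ e) p<m k<n = begin
      par (invAbs (q ∷ ps)) xor invDefect (suc k) (t % n)
        ≡⟨ invAbs-prepend q ps (invDefect (suc k) (t % n)) ⟩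
      par (invAbs ps) xor (par (countAbs (absPos q) ps) xor invDefect (suc k) (t % n))
        ≡⟨ cong (λ z → par (invAbs ps) xor (par z xor invDefect (suc k) (t % n))) below ⟩
      par (invAbs ps) xor (par (k ∸ (if t % n + k <ᵇ n then 0 else n ∸ t % n)) xor invDefect (suc k) (t % n))
        ≡⟨ cong (par (invAbs ps) xor_) (defect-stepʳ (t % n) k (m%n<n t n) (s≤s z≤n) k<n) ⟩
      par (invAbs ps) xor (invDefect k (t % n) xor par (n ∸ k ∸ 1))
        ≡⟨ BoolP.xor-assoc (par (invAbs ps)) (invDefect k (t % n)) (par (n ∸ k ∸ 1)) ⟨
      (par (invAbs ps) xor invDefect k (t % n)) xor par (n ∸ k ∸ 1)
        ≡⟨ cong (_xor par (n ∸ k ∸ 1)) (inv-parity-invariant p e p<m (ℕP.<⇒≤ k<n)) ⟩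
      par (invTarget p e) xor par (n ∸ k ∸ 1)
        ≡⟨ invTarget-right p e ⟨
      par (invTarget p (true ∷ e)) ∎
    where
    open ≡-Reasoning
    ps = arcWord p e
    t = arcStart p e
    k = suc (length e)
    q = shift t k
    below : countAbs (absPos q) ps ≡ k ∸ (if t % n + k <ᵇ n then 0 else n ∸ t % n)
    below = trans (countAbs-arcWord p e p<m (ℕP.<⇒≤ k<n) (absPos q))
                  (trans (cong (countBelow t k) (absPos-shift t k)) (countBelowʳ t k k<n))

  invDefect-full : ∀ c → c < n → invDefect n c ≡ false
  invDefect-full zero _ rewrite <ᵇ-f {n} {n} ℕP.≤-refl with par n
  ... | true  = refl
  ... | false = refl
  invDefect-full (suc c0) _ rewrite <ᵇ-t {n} {suc c0 + n} (s≤s (ℕP.m≤n+m n c0)) with par n | par c0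
  ... | true  | true  = refl
  ... | true  | false = refl
  ... | false | true  = refl
  ... | false | false = refl

  inv-parity : ∀ p e → p < m → length e ≡ n' → par (invAbs (arcWord p e)) ≡ par (invTarget p e)
  inv-parity p e p<m refl = begin
      par I                                ≡⟨ BoolP.xor-identityʳ _ ⟨
      par I xor false                      ≡⟨ cong (par I xor_) (invDefect-full (t % n) (m%n<n t n)) ⟨
      par I xor invDefect n (t % n)        ≡⟨ inv-parity-invariant p e p<m ℕP.≤-refl ⟩
      par (invTarget p e)                  ∎
    where
    open ≡-Reasoning
    I = invAbs (arcWord p e)
    t = arcStart p e

-- By the enumeration, Σ_π w(π) q^fmaj(π) is a
-- sum over p < 2n and e ∈ {0,1}^(n-1); we index the steps of a complete e
-- by i = 1,…,n-1 (stepSum).  If the weight is (-1)^X with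
-- X ≡ a·(2n-1-p) + Σ_{right steps} g(i) (mod 2), then by the fmaj formula
-- the summand factors as  ((-1)^a q)^(2n-1-p) · Π_{right steps} (-1)^g(i) q^(2i-1),
-- and summing gives  [2n]_{(-1)^a q} · Π_{i=1}^{n-1} (1 + (-1)^g(i) q^(2i-1)).
module GeneratingFunction (n' : ℕ) where

  open import Defs
  open PolynomialArithmetic
  open FiniteSums
  open Parity
  open Circle n' using (n; m)
  open ArcEnumeration n' using (arcPerm; isBArcWord; enumerate-BArc)
  open FmajFormula n' using (rightSum; oddExp; fmaj-arcPerm)
  open import Data.Bool using (Bool; true; false; if_then_else_)
  open import Data.Nat using (ℕ; zero; suc; _<_; _≤_; _∸_; _+_; _*_)
  import Data.Nat.Properties as ℕP
  open import Data.Integer as ℤ using (ℤ)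
  open import Data.List using (List; []; _∷_; map; length; applyUpTo)
  open import Relation.Binary.PropositionalEquality
  open import Function using (_∘_)

  stepSum : (ℕ → ℕ) → (ℕ → ℕ) → List Bool → ℕ
  stepSum g f []      = 0
  stepSum g f (b ∷ e) = (if b then g (f 0) else 0) + stepSum g (f ∘ suc) e

  rightSum≡stepSum : ∀ g e (f : ℕ → ℕ) → length e ≤ n → (∀ i → f i ≡ (n ∸ length e) + i) →
    rightSum g e ≡ stepSum g f e
  rightSum≡stepSum g []      f _   _  = refl
  rightSum≡stepSum g (b ∷ e) f len hf =
    cong₂ _+_ (cong (λ z → if b then g z else 0) (sym (trans (hf 0) (ℕP.+-identityʳ _))))
      (rightSum≡stepSum g e (f ∘ suc) (ℕP.<⇒≤ len)
        (λ i → trans (hf (suc i)) (trans (ℕP.+-suc _ i) (cong (_+ i) (sym (ℕP.+-∸-assoc 1 len))))))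

  rightSum-complete : ∀ g e → length e ≡ n' → rightSum g e ≡ stepSum g suc e
  rightSum-complete g e refl = rightSum≡stepSum g e suc (ℕP.n≤1+n n') (λ i → cong (_+ i) (sym (ℕP.m+n∸n≡m 1 n')))

  fmaj-complete : ∀ p e → p < m → length e ≡ n' → fmaj n (arcPerm p e) ≡ (m ∸ suc p) + stepSum oddExp suc e
  fmaj-complete p e p<m len =
    trans (fmaj-arcPerm p e p<m len) (cong ((m ∸ suc p) +_) (rightSum-complete oddExp e len))

  factor : (ℕ → ℕ) → ℕ → Poly
  factor g i = oneP ⊕ monoP (negOnePow (g i)) (oddExp i)

  prod-expand : ∀ g j (f : ℕ → ℕ) → prodP (map (factor g) (applyUpTo f j))
    ≋ ΣBits j (λ e → monoP (negOnePow (stepSum g f e)) (stepSum oddExp f e))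
  prod-expand g zero    f = ≈refl
  prod-expand g (suc j) f = begin
      factor g (f 0) ⊗ prodP (map (factor g) (applyUpTo (f ∘ suc) j))
        ≈⟨ ⊗-congʳ (factor g (f 0)) (prod-expand g j (f ∘ suc)) ⟩
      (oneP ⊕ M) ⊗ ΣBits j T
        ≈⟨ ⊗-distribʳ oneP M (ΣBits j T) ⟩
      oneP ⊗ ΣBits j T ⊕ M ⊗ ΣBits j T
        ≈⟨ ⊕-cong (oneP-⊗ (ΣBits j T)) (ΣBits-⊗ˡ j T M) ⟩
      ΣBits j T ⊕ ΣBits j (λ e → M ⊗ T e)
        ≈⟨ ⊕-cong (≈refl {ΣBits j T}) (ΣBits-cong j (λ e _ → ≈trans
             (mono-⊗ (negOnePow (g (f 0))) (oddExp (f 0)) (negOnePow (stepSum g (f ∘ suc) e)) (stepSum oddExp (f ∘ suc) e))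
             (mono-cong (sym (negOnePow-+ (g (f 0)) (stepSum g (f ∘ suc) e))) refl))) ⟩
      ΣBits j (λ e → Term (false ∷ e)) ⊕ ΣBits j (λ e → Term (true ∷ e))
        ≈⟨ ΣBits-head j Term ⟨
      ΣBits (suc j) Term ∎
    where
    open ≋-Reasoning
    M = monoP (negOnePow (g (f 0))) (oddExp (f 0))
    T : List Bool → Poly
    T e = monoP (negOnePow (stepSum g (f ∘ suc) e)) (stepSum oddExp (f ∘ suc) e)
    Term : List Bool → Poly
    Term e = monoP (negOnePow (stepSum g f e)) (stepSum oddExp f e)

  genFun-enum : ∀ (w : List ℤ → ℤ) →
    genFun n w ≋ Σ< m (λ p → ΣBits n' (λ e → monoP (w (arcPerm p e)) (fmaj n (arcPerm p e))))
  genFun-enum w = begin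
      ΣL (ABn n) f
        ≈⟨ ΣL-filter (isBArc n) (Bn n) f ⟩
      ΣL (Bn n) (λ π → onlyIf (isBArc n π) (f π))
        ≈⟨ ΣL-filter isSignedPerm (words n (alphabet n)) (λ π → onlyIf (isBArc n π) (f π)) ⟩
      ΣL (words n (alphabet n)) (λ π → onlyIf (isSignedPerm π) (onlyIf (isBArc n π) (f π)))
        ≈⟨ ΣL-cong (words n (alphabet n)) (λ π → ≡⇒≋ (onlyIf-∧ (isSignedPerm π) (isBArc n π) (f π))) ⟩
      ΣL (words n (alphabet n)) (λ π → onlyIf (isBArcWord π) (f π))
        ≈⟨ enumerate-BArc n' f ℕP.≤-refl ⟩
      Σ< m (λ p → ΣBits n' (λ e → f (arcPerm p e))) ∎
    where
    open ≋-Reasoning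
    f : List ℤ → Poly
    f π = monoP (w π) (fmaj n π)

  genFun-factorises : ∀ (w : List ℤ → ℤ) (a : ℕ) (g : ℕ → ℕ) (X : ℕ → List Bool → ℕ) →
    (∀ p e → p < m → length e ≡ n' → w (arcPerm p e) ≡ negOnePow (X p e)) →
    (∀ p e → p < m → length e ≡ n' → par (X p e) ≡ par (a * (m ∸ suc p) + stepSum g suc e)) →
    genFun n w ≋ qInt (negOnePow a) m ⊗ prodFactor (λ i → negOnePow (g i)) n
  genFun-factorises w a g X weight parity = begin
      genFun n w
        ≈⟨ genFun-enum w ⟩
      Σ< m (λ p → ΣBits n' (λ e → monoP (w (arcPerm p e)) (fmaj n (arcPerm p e))))
        ≈⟨ Σ<-cong m (λ p p<m → ΣBits-cong n' (λ e len → mono-cong (coefficient p e p<m len) (fmaj-complete p e p<m len))) ⟩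
      Σ< m (λ p → G (m ∸ suc p))
        ≈⟨ Σ<-rev m G ⟩
      Σ< m G
        ≈⟨ Σ<-cong m (λ j _ → ≈trans (ΣBits-⊗ˡ n' T (Q j)) (ΣBits-cong n' (λ e _ → split j e))) ⟨
      Σ< m (λ j → Q j ⊗ ΣBits n' T)
        ≈⟨ Σ<-⊗ʳ m Q (ΣBits n' T) ⟨
      Σ< m Q ⊗ ΣBits n' T
        ≈⟨ ⊗-cong (≡⇒≋ (sym (ΣL-upTo m Q))) (≈sym (prod-expand g n' suc)) ⟩
      qInt (negOnePow a) m ⊗ prodFactor (λ i → negOnePow (g i)) n ∎
    where
    open ≋-Reasoning
    Q : ℕ → Poly
    Q j = monoP (negOnePow a ℤ.^ j) j
    T : List Bool → Poly
    T e = monoP (negOnePow (stepSum g suc e)) (stepSum oddExp suc e)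
    G : ℕ → Poly
    G j = ΣBits n' (λ e → monoP (negOnePow (a * j + stepSum g suc e)) (j + stepSum oddExp suc e))
    coefficient : ∀ p e → p < m → length e ≡ n' →
      w (arcPerm p e) ≡ negOnePow (a * (m ∸ suc p) + stepSum g suc e)
    coefficient p e p<m len = trans (weight p e p<m len)
      (negOnePow-≡ (X p e) (a * (m ∸ suc p) + stepSum g suc e) (parity p e p<m len))
    split : ∀ j e → Q j ⊗ T e ≋ monoP (negOnePow (a * j + stepSum g suc e)) (j + stepSum oddExp suc e)
    split j e = ≈trans (mono-⊗ (negOnePow a ℤ.^ j) j (negOnePow (stepSum g suc e)) (stepSum oddExp suc e))
      (mono-cong (trans (cong (ℤ._* negOnePow (stepSum g suc e)) (negOnePow-^ a j))
                        (sym (negOnePow-+ (a * j) (stepSum g suc e)))) refl)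

-- The four identities: the weights 1, sign, (-1)^neg and sign(|π|)
-- satisfy the parity hypothesis of genFun-factorises with
-- (a, g) = (0, 0), (n, i), (1, 1) and (n-1, i-1) respectively.
module FourIdentities (n' : ℕ) where

  open import Defs
  open PolynomialArithmetic
  open Parity
  open Circle n' using (n; m)
  open ArcEnumeration n' using (arcWord; arcPerm)
  open LetterStatistics n' using (inv-letters)
  open FmajFormula n' using (oddExp)
  open InversionParity n' using (inv-parity)
  open GeneratingFunction n'
  open import Data.Bool using (Bool; true; false; not; _∧_; _xor_; if_then_else_)
  import Data.Bool.Properties as BoolP
  open import Data.Nat using (ℕ; suc; _<_; _∸_; _+_; _*_)
  import Data.Nat.Properties as ℕP
  open import Data.Integer as ℤ using ()
  open import Data.List using ([]; _∷_; map; length)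
  open import Relation.Binary.PropositionalEquality
  open import Function using (_∘_)
  open import Algebra.Properties.CommutativeSemigroup ℕP.+-commutativeSemigroup
    using () renaming (interchange to +-interchange)

  stepSum-zero : ∀ (f : ℕ → ℕ) e → stepSum (λ _ → 0) f e ≡ 0
  stepSum-zero f []          = refl
  stepSum-zero f (true ∷ e)  = stepSum-zero (f ∘ suc) e
  stepSum-zero f (false ∷ e) = stepSum-zero (f ∘ suc) e

  stepSum-+ : ∀ g₁ g₂ (f : ℕ → ℕ) e → stepSum (λ i → g₁ i + g₂ i) f e ≡ stepSum g₁ f e + stepSum g₂ f e
  stepSum-+ g₁ g₂ f []          = refl
  stepSum-+ g₁ g₂ f (false ∷ e) = stepSum-+ g₁ g₂ (f ∘ suc) e
  stepSum-+ g₁ g₂ f (true ∷ e) rewrite stepSum-+ g₁ g₂ (f ∘ suc) e =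
    +-interchange (g₁ (f 0)) (g₂ (f 0)) (stepSum g₁ (f ∘ suc) e) (stepSum g₂ (f ∘ suc) e)

  stepSum-cong : ∀ g₁ g₂ (f : ℕ → ℕ) e → (∀ i → g₁ (f i) ≡ g₂ (f i)) → stepSum g₁ f e ≡ stepSum g₂ f e
  stepSum-cong g₁ g₂ f []      h = refl
  stepSum-cong g₁ g₂ f (b ∷ e) h =
    cong₂ _+_ (cong (λ z → if b then z else 0) (h 0)) (stepSum-cong g₁ g₂ (f ∘ suc) e (h ∘ suc))

  stepSum-par : ∀ g₁ g₂ (f : ℕ → ℕ) e → (∀ i → par (g₁ (f i)) ≡ par (g₂ (f i))) →
    par (stepSum g₁ f e) ≡ par (stepSum g₂ f e)
  stepSum-par g₁ g₂ f []          h = refl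
  stepSum-par g₁ g₂ f (false ∷ e) h = stepSum-par g₁ g₂ (f ∘ suc) e (h ∘ suc)
  stepSum-par g₁ g₂ f (true ∷ e)  h = begin
      par (g₁ (f 0) + stepSum g₁ (f ∘ suc) e)           ≡⟨ par-+ (g₁ (f 0)) _ ⟩
      par (g₁ (f 0)) xor par (stepSum g₁ (f ∘ suc) e)   ≡⟨ cong₂ _xor_ (h 0) (stepSum-par g₁ g₂ (f ∘ suc) e (h ∘ suc)) ⟩
      par (g₂ (f 0)) xor par (stepSum g₂ (f ∘ suc) e)   ≡⟨ par-+ (g₂ (f 0)) _ ⟨
      par (g₂ (f 0) + stepSum g₂ (f ∘ suc) e)           ∎
    where open ≡-Reasoning

  par-oddExp : ∀ i → par (oddExp (suc i)) ≡ par 1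
  par-oddExp i = trans (par-+ i (suc (i + 0)))
    (trans (cong (λ z → par i xor not (par z)) (ℕP.+-identityʳ i)) (BoolP.xor-inverseʳ (par i)))

  par-neg : ∀ π → par (neg π) ≡ par (fmaj n π)
  par-neg π = sym (trans (par-+ (2 * maj n π) (neg π)) (cong (_xor par (neg π)) (par-* 2 (maj n π))))

  par-neg-arcPerm : ∀ p e → p < m → length e ≡ n' →
    par (neg (arcPerm p e)) ≡ par (m ∸ suc p) xor par (stepSum (λ _ → 1) suc e)
  par-neg-arcPerm p e p<m len = begin
      par (neg (arcPerm p e))                          ≡⟨ par-neg (arcPerm p e) ⟩
      par (fmaj n (arcPerm p e))                       ≡⟨ cong par (fmaj-complete p e p<m len) ⟩
      par ((m ∸ suc p) + stepSum oddExp suc e)         ≡⟨ par-+ (m ∸ suc p) _ ⟩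
      par (m ∸ suc p) xor par (stepSum oddExp suc e)   ≡⟨ cong (par (m ∸ suc p) xor_) (stepSum-par oddExp (λ _ → 1) suc e par-oddExp) ⟩
      par (m ∸ suc p) xor par (stepSum (λ _ → 1) suc e) ∎
    where open ≡-Reasoning

  par-inv-arcPerm : ∀ p e → p < m → length e ≡ n' →
    par (inv (map ℤ.∣_∣ (arcPerm p e))) ≡ par ((n ∸ 1) * (m ∸ suc p) + stepSum (_∸ 1) suc e)
  par-inv-arcPerm p e p<m len =
    trans (cong par (inv-letters (arcWord p e)))
      (trans (inv-parity p e p<m len)
             (cong (λ z → par ((n ∸ 1) * (m ∸ suc p) + z)) (rightSum-complete (_∸ 1) e len)))

  identity-plain : genFun n (λ _ → ℤ.+ 1) ≋ qInt (ℤ.+ 1) (2 * n) ⊗ prodFactor (λ _ → ℤ.+ 1) n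
  identity-plain = genFun-factorises (λ _ → ℤ.+ 1) 0 (λ _ → 0) (λ _ _ → 0) (λ _ _ _ _ → refl)
    (λ p e _ _ → cong par (sym (stepSum-zero suc e)))

  identity-negSign : genFun n (λ π → negOnePow (neg π)) ≋ qInt (ℤ.- (ℤ.+ 1)) (2 * n) ⊗ prodFactor (λ _ → ℤ.- (ℤ.+ 1)) n
  identity-negSign = genFun-factorises (λ π → negOnePow (neg π)) 1 (λ _ → 1) (λ p e → neg (arcPerm p e))
    (λ _ _ _ _ → refl)
    (λ p e p<m len → trans (par-neg-arcPerm p e p<m len)
      (sym (trans (par-+ (1 * (m ∸ suc p)) _) (cong (λ z → par z xor par (stepSum (λ _ → 1) suc e)) (ℕP.*-identityˡ (m ∸ suc p))))))

  identity-absSign : genFun n signAbs ≋ qInt (negOnePow (n ∸ 1)) (2 * n) ⊗ prodFactor (λ i → negOnePow (i ∸ 1)) n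
  identity-absSign = genFun-factorises signAbs (n ∸ 1) (_∸ 1) (λ p e → inv (map ℤ.∣_∣ (arcPerm p e)))
    (λ _ _ _ _ → refl) par-inv-arcPerm

  -- sign = (-1)^(neg + inv|π|); the parities combine since i = 1 + (i-1)
  -- for i ≥ 1 and n·j ≡ j + (n-1)·j.
  identity-sign : genFun n signB ≋ qInt (negOnePow n) (2 * n) ⊗ prodFactor (λ i → negOnePow i) n
  identity-sign = genFun-factorises signB n (λ i → i) (λ p e → neg (arcPerm p e) + inv (map ℤ.∣_∣ (arcPerm p e)))
    (λ p e _ _ → sym (negOnePow-+ (neg (arcPerm p e)) _)) parity
    where
    table : ∀ x pj A B → (pj xor A) xor ((x ∧ pj) xor B) ≡ (not x ∧ pj) xor (A xor B)
    table true  true  true  true  = refl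
    table true  true  true  false = refl
    table true  true  false true  = refl
    table true  true  false false = refl
    table true  false A     B     = refl
    table false true  true  true  = refl
    table false true  true  false = refl
    table false true  false true  = refl
    table false true  false false = refl
    table false false A     B     = refl
    parity : ∀ p e → p < m → length e ≡ n' →
      par (neg (arcPerm p e) + inv (map ℤ.∣_∣ (arcPerm p e))) ≡ par (n * (m ∸ suc p) + stepSum (λ i → i) suc e)
    parity p e p<m len = begin
        par (neg (arcPerm p e) + inv (map ℤ.∣_∣ (arcPerm p e)))
          ≡⟨ par-+ (neg (arcPerm p e)) _ ⟩
        par (neg (arcPerm p e)) xor par (inv (map ℤ.∣_∣ (arcPerm p e)))
          ≡⟨ cong₂ _xor_ (par-neg-arcPerm p e p<m len)
                         (trans (par-inv-arcPerm p e p<m len) (trans (par-+ (n' * j) B) (cong (_xor par B) (par-* n' j)))) ⟩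
        (par j xor par A) xor ((par n' ∧ par j) xor par B)
          ≡⟨ table (par n') (par j) (par A) (par B) ⟩
        (not (par n') ∧ par j) xor (par A xor par B)
          ≡⟨ cong₂ _xor_ (sym (par-* n j)) (trans (sym (par-+ A B)) (cong par (sym (stepSum-+ (λ _ → 1) (_∸ 1) suc e)))) ⟩
        par (n * j) xor par (stepSum (λ i → 1 + (i ∸ 1)) suc e)
          ≡⟨ cong (λ z → par (n * j) xor par z) (stepSum-cong (λ i → 1 + (i ∸ 1)) (λ i → i) suc e (λ i → refl)) ⟩
        par (n * j) xor par (stepSum (λ i → i) suc e)
          ≡⟨ par-+ (n * j) (stepSum (λ i → i) suc e) ⟨
        par (n * j + stepSum (λ i → i) suc e) ∎
      where
      open ≡-Reasoning
      j = m ∸ suc p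
      A = stepSum (λ _ → 1) suc e
      B = stepSum (_∸ 1) suc e


open import Defs
open import Data.Nat using (ℕ; _≤_; _∸_; _*_; suc)
open import Data.Integer using (+_; -_)
open import Data.Product using (_×_; _,_)

theorem5p8 : (n : ℕ) → 1 ≤ n →
    (genFun n (λ _ → + 1) ≈P qInt (+ 1) (2 * n) ⊗ prodFactor (λ _ → + 1) n)
    × (genFun n signB ≈P qInt (negOnePow n) (2 * n) ⊗ prodFactor (λ i → negOnePow i) n)
    × (genFun n (λ π → negOnePow (neg π)) ≈P qInt (- (+ 1)) (2 * n) ⊗ prodFactor (λ _ → - (+ 1)) n)
    × (genFun n signAbs ≈P qInt (negOnePow (n ∸ 1)) (2 * n) ⊗ prodFactor (λ i → negOnePow (i ∸ 1)) n)
theorem5p8 (suc n') _ =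
  get identity-plain , get identity-sign , get identity-negSign , get identity-absSign
  where
  open PolynomialArithmetic using (get)
  open FourIdentities n'
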